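{- (a) There is no integer $n$ and set $S$ such that the circulant $\mathsf{Circ}(n,S)$ is an $(r,c)$-graph with $c \equiv 2 \pmod 3$. (b) For all integers $c > 0$ with $c \equiv 0$ or $1 \pmod 3$, and all integers $r \geq 6 + \sqrt{\frac{8c-5}{3}}$, there exists an $(r,c)$-circulant. (c) For every integer $r \geq 1$ there exists an $(r,0)$-circulant.
   Context: All graphs are finite and simple. For a vertex $v$ of a graph $G$, $e(v)$ denotes the number of edges of the subgraph of $G$ induced by the open neighbourhood $N(v)$. An $(r,c)$-graph is an $r$-regular graph with $e(v) = c$ for every vertex $v$. For an integer $n \geq 2$ and a set $S \subseteq \{1, \dots, \lfloor n/2 \rfloor\}$ (the jumps), the circulant $\mathsf{Circ}(n,S)$ is the Cayley graph of $\mathbb{Z}_n$ with connection set $S \cup -S$: its vertex set is $\mathbb{Z}_n$ and $u, w$ are adjacent iff $w - u \in S \cup -S$. An $(r,c)$-circulant is a circulant that is an $(r,c)$-graph. -}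

module Defs where

open import Data.Bool using (Bool; true; false; if_then_else_; _∧_; _∨_)
open import Data.Nat using (ℕ; _+_; _∸_; _≤ᵇ_; _<ᵇ_; _≡ᵇ_; _≤_; _/_)
open import Data.Fin using (Fin; toℕ)
open import Data.List using (List; length; filterᵇ; allFin; cartesianProduct)
open import Data.Bool.ListAction using (any)
open import Data.List.Relation.Unary.All using (All)
open import Data.Product using (_×_; _,_)
open import Relation.Binary.PropositionalEquality using (_≡_)

ValidJumps : ℕ → List ℕ → Set
ValidJumps n S = All (λ s → 1 ≤ s × s ≤ n / 2) S

elemᵇ : ℕ → List ℕ → Bool
elemᵇ d S = any (λ s → d ≡ᵇ s) S

diffMod : (n : ℕ) → Fin n → Fin n → ℕ
diffMod n u w =
  if toℕ u ≤ᵇ toℕ w then toℕ w ∸ toℕ u else (n + toℕ w) ∸ toℕ u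

-- Adjacency in Circ(n,S): w - u ∈ S ∪ -S (mod n).
circAdj : (n : ℕ) → List ℕ → Fin n → Fin n → Bool
circAdj n S u w = elemᵇ (diffMod n u w) S ∨ elemᵇ (n ∸ diffMod n u w) S

degree : (n : ℕ) → List ℕ → Fin n → ℕ
degree n S v = length (filterᵇ (circAdj n S v) (allFin n))

eNbhd : (n : ℕ) → List ℕ → Fin n → ℕ
eNbhd n S v = length (filterᵇ ok (cartesianProduct (allFin n) (allFin n)))
  where
    ok : Fin n × Fin n → Bool
    ok (a , b) = (toℕ a <ᵇ toℕ b) ∧ circAdj n S v a ∧ circAdj n S v b ∧ circAdj n S a b

IsRCCirc : (n : ℕ) → List ℕ → ℕ → ℕ → Set
IsRCCirc n S r c = (v : Fin n) → degree n S v ≡ r × eNbhd n S v ≡ c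

ExistsRCCirculant : ℕ → ℕ → Set
ExistsRCCirculant r c =
  Data.Product.Σ ℕ λ n → Data.Product.Σ (List ℕ) λ S →
    2 ≤ n × ValidJumps n S × IsRCCirc n S r c

-- (a) Twice e(v) counts the ordered pairs (x, y) with x, y, y − x ∈ S ∪ −S (triangles through 0,
-- after translating v to 0). The map (x, y) ↦ (y − x, −x) has order three and preserves them; its
-- fixed points are the pairs (x, −x) with 3x ≡ 0 (mod n), and at most two of them, x = n/3 and
-- x = 2n/3, are triangles, either both or neither. So 2c ≡ 0 or 2 (mod 3), i.e. c ≢ 2 (mod 3).
--
-- (b), (c) Take n = 6M and S = D ∪ {2M if e₃} ∪ {3M if e₂} with D a set of small positive
-- numbers (3d < M). The only triangles through 0 come from Schur triples x + y = z in D and from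
-- the triangle {0, 2M, 4M}, so r = 2|D| + 2e₃ + e₂ and c = 3·s(D) + e₃, where s(D) counts the
-- ordered pairs (x, y) in D with x + y ∈ D. The sets {1, …, k} ∪ {2k + 1 − m} have
-- s = k(k − 1)/2 + m, every number has this form with m < k, and padding by rapidly growing
-- elements enlarges |D| at will; the bound on r is exactly what makes 2(k + 1 + e₃) ≤ r.

module Submission where

open import Defs
open import Data.Nat using (ℕ; _+_; _*_; _∸_; _^_; _≤_; _<_; _%_)
open import Data.List using (List)
open import Data.Product using (_×_)
open import Data.Sum using (_⊎_)
open import Relation.Binary.PropositionalEquality using (_≡_; _≢_)

open import Data.Bool using (Bool; true; false; if_then_else_; _∧_; _∨_; not; T)
open import Data.Bool.Properties
  using (∧-comm; ∧-assoc; ∧-identityʳ; ∧-zeroʳ; ∨-comm; ∨-assoc; ∨-identityʳ; ∨-zeroʳ; ∨-idem; T-≡)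
open import Data.Empty using (⊥; ⊥-elim)
open import Data.Fin using (Fin; toℕ; zero; suc; fromℕ<)
open import Data.Fin.Properties using (toℕ<n)
open import Data.List using ([]; _∷_; _++_; length; filterᵇ; allFin; cartesianProduct; map; tabulate)
open import Data.List.Properties using (length-++; length-map)
open import Data.List.Relation.Unary.All using (All; []; _∷_)
import Data.List.Relation.Unary.All as All
open import Data.List.Relation.Unary.All.Properties using (++⁺; map⁺)
open import Data.Nat
open import Data.Nat.DivMod
open import Data.Nat.Divisibility using (_∣_; divides; _∣?_)
open import Data.Nat.Properties
open import Data.Nat.Tactic.RingSolver using (solve-∀)
open import Algebra.Properties.CommutativeSemigroup +-commutativeSemigroup using () renaming (interchange to +-interchange)
open import Data.Product using (_,_; proj₁; proj₂; Σ)
open import Data.Sum using (inj₁; inj₂)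
open import Data.Unit using (tt; ⊤)
open import Function using (_∘_; id)
open import Function.Bundles using (Equivalence)
open import Relation.Binary.Definitions using (tri<; tri≈; tri>)
open import Relation.Binary.PropositionalEquality
open import Relation.Nullary using (¬_; yes; no; contradiction)
open ≡-Reasoning

-- Finite sums and counting

𝟙 : Bool → ℕ
𝟙 true = 1
𝟙 false = 0

𝟙≤1 : ∀ b → 𝟙 b ≤ 1
𝟙≤1 true = ≤-refl
𝟙≤1 false = z≤n

𝟙-∧ : ∀ a b → 𝟙 (a ∧ b) ≡ 𝟙 a * 𝟙 b
𝟙-∧ true b = sym (+-identityʳ (𝟙 b))
𝟙-∧ false b = refl

𝟙-∨-disjoint : ∀ a b → (a ≡ true → b ≡ false) → 𝟙 (a ∨ b) ≡ 𝟙 a + 𝟙 b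
𝟙-∨-disjoint true b h rewrite h refl = refl
𝟙-∨-disjoint false b h = refl

sumBelow : ℕ → (ℕ → ℕ) → ℕ
sumBelow zero f = 0
sumBelow (suc n) f = f 0 + sumBelow n (f ∘ suc)

sumOver : {A : Set} → List A → (A → ℕ) → ℕ
sumOver [] f = 0
sumOver (x ∷ xs) f = f x + sumOver xs f

sumBelow-cong : ∀ n {f g : ℕ → ℕ} → (∀ i → i < n → f i ≡ g i) → sumBelow n f ≡ sumBelow n g
sumBelow-cong zero h = refl
sumBelow-cong (suc n) h = cong₂ _+_ (h 0 z<s) (sumBelow-cong n (λ i i<n → h (suc i) (s<s i<n)))

sumBelow-zero : ∀ n (f : ℕ → ℕ) → (∀ i → i < n → f i ≡ 0) → sumBelow n f ≡ 0
sumBelow-zero zero f h = refl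
sumBelow-zero (suc n) f h = cong₂ _+_ (h 0 z<s) (sumBelow-zero n (f ∘ suc) (λ i i<n → h (suc i) (s<s i<n)))

sumBelow-+ : ∀ n (f g : ℕ → ℕ) → sumBelow n (λ i → f i + g i) ≡ sumBelow n f + sumBelow n g
sumBelow-+ zero f g = refl
sumBelow-+ (suc n) f g =
  trans (cong (f 0 + g 0 +_) (sumBelow-+ n (f ∘ suc) (g ∘ suc))) (+-interchange (f 0) (g 0) _ _)

sumBelow-*ˡ : ∀ n k (f : ℕ → ℕ) → sumBelow n (λ i → k * f i) ≡ k * sumBelow n f
sumBelow-*ˡ zero k f = sym (*-zeroʳ k)
sumBelow-*ˡ (suc n) k f =
  trans (cong (k * f 0 +_) (sumBelow-*ˡ n k (f ∘ suc))) (sym (*-distribˡ-+ k (f 0) _))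

sumBelow-+-range : ∀ a b (f : ℕ → ℕ) → sumBelow (a + b) f ≡ sumBelow a f + sumBelow b (λ i → f (a + i))
sumBelow-+-range zero b f = refl
sumBelow-+-range (suc a) b f =
  trans (cong (f 0 +_) (sumBelow-+-range a b (f ∘ suc))) (sym (+-assoc (f 0) _ _))

sumBelow-last : ∀ n (f : ℕ → ℕ) → sumBelow (suc n) f ≡ sumBelow n f + f n
sumBelow-last n f = begin
  sumBelow (suc n) f                      ≡⟨ cong (λ k → sumBelow k f) (+-comm 1 n) ⟩
  sumBelow (n + 1) f                      ≡⟨ sumBelow-+-range n 1 f ⟩
  sumBelow n f + (f (n + 0) + 0)          ≡⟨ cong (λ k → sumBelow n f + (f k + 0)) (+-identityʳ n) ⟩
  sumBelow n f + (f n + 0)                ≡⟨ cong (sumBelow n f +_) (+-identityʳ (f n)) ⟩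
  sumBelow n f + f n                      ∎

sumBelow-swap : ∀ n m (f : ℕ → ℕ → ℕ) →
  sumBelow n (λ a → sumBelow m (f a)) ≡ sumBelow m (λ b → sumBelow n (λ a → f a b))
sumBelow-swap zero m f = sym (sumBelow-zero m _ (λ _ _ → refl))
sumBelow-swap (suc n) m f =
  trans (cong (sumBelow m (f 0) +_) (sumBelow-swap n m (f ∘ suc)))
        (sym (sumBelow-+ m (f 0) (λ b → sumBelow n (λ a → f (suc a) b))))

sumBelow-reverse : ∀ m (f : ℕ → ℕ) → sumBelow m f ≡ sumBelow m (λ i → f (m ∸ suc i))
sumBelow-reverse zero f = refl
sumBelow-reverse (suc m) f = begin
  sumBelow (suc m) f                            ≡⟨ sumBelow-last m f ⟩
  sumBelow m f + f m                            ≡⟨ cong (_+ f m) (sumBelow-reverse m f) ⟩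
  sumBelow m (λ i → f (m ∸ suc i)) + f m        ≡⟨ +-comm _ (f m) ⟩
  f m + sumBelow m (λ i → f (m ∸ suc i))        ∎

sumBelow-delta : ∀ n a (g : ℕ → ℕ) → a < n → sumBelow n (λ x → 𝟙 (x ≡ᵇ a) * g x) ≡ g a
sumBelow-delta (suc n) zero g _ =
  trans (cong₂ _+_ (*-identityˡ (g 0)) (sumBelow-zero n _ (λ _ _ → refl))) (+-identityʳ (g 0))
sumBelow-delta (suc n) (suc a) g (s<s a<n) = sumBelow-delta n a (g ∘ suc) a<n

sumOver-++ : {A : Set} (xs ys : List A) (f : A → ℕ) → sumOver (xs ++ ys) f ≡ sumOver xs f + sumOver ys f
sumOver-++ [] ys f = refl
sumOver-++ (x ∷ xs) ys f = trans (cong (f x +_) (sumOver-++ xs ys f)) (sym (+-assoc (f x) _ _))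

sumOver-map : {A B : Set} (g : A → B) (xs : List A) (f : B → ℕ) → sumOver (map g xs) f ≡ sumOver xs (f ∘ g)
sumOver-map g [] f = refl
sumOver-map g (x ∷ xs) f = cong (f (g x) +_) (sumOver-map g xs f)

sumOver-cong : {A : Set} (xs : List A) {f g : A → ℕ} → All (λ x → f x ≡ g x) xs → sumOver xs f ≡ sumOver xs g
sumOver-cong [] [] = refl
sumOver-cong (x ∷ xs) (p ∷ ps) = cong₂ _+_ p (sumOver-cong xs ps)

sumOver-cong′ : {A : Set} (xs : List A) {f g : A → ℕ} → (∀ x → f x ≡ g x) → sumOver xs f ≡ sumOver xs g
sumOver-cong′ xs h = sumOver-cong xs (All.tabulate (λ {x} _ → h x))

sumOver-+ : {A : Set} (xs : List A) (f g : A → ℕ) → sumOver xs (λ i → f i + g i) ≡ sumOver xs f + sumOver xs g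
sumOver-+ [] f g = refl
sumOver-+ (x ∷ xs) f g = trans (cong (f x + g x +_) (sumOver-+ xs f g)) (+-interchange (f x) (g x) _ _)

sumOver-zero : {A : Set} (xs : List A) → sumOver xs (λ _ → 0) ≡ 0
sumOver-zero [] = refl
sumOver-zero (x ∷ xs) = sumOver-zero xs

sumOver-const1 : {A : Set} (xs : List A) → sumOver xs (λ _ → 1) ≡ length xs
sumOver-const1 [] = refl
sumOver-const1 (x ∷ xs) = cong suc (sumOver-const1 xs)

sumOver-swap : {A B : Set} (xs : List A) (ys : List B) (f : A → B → ℕ) →
  sumOver xs (λ a → sumOver ys (f a)) ≡ sumOver ys (λ b → sumOver xs (λ a → f a b))
sumOver-swap [] ys f = sym (sumOver-zero ys)
sumOver-swap (x ∷ xs) ys f = trans (cong (sumOver ys (f x) +_) (sumOver-swap xs ys f))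
  (sym (sumOver-+ ys (f x) (λ b → sumOver xs (λ a → f a b))))

sumOver-tabulate : {A : Set} (n : ℕ) (g : Fin n → A) (h : A → ℕ) (h′ : ℕ → ℕ) →
  (∀ i → h (g i) ≡ h′ (toℕ i)) → sumOver (tabulate g) h ≡ sumBelow n h′
sumOver-tabulate zero g h h′ e = refl
sumOver-tabulate (suc n) g h h′ e =
  cong₂ _+_ (e zero) (sumOver-tabulate n (g ∘ suc) h (h′ ∘ suc) (e ∘ suc))

length-filterᵇ : {A : Set} (p : A → Bool) (xs : List A) → length (filterᵇ p xs) ≡ sumOver xs (𝟙 ∘ p)
length-filterᵇ p [] = refl
length-filterᵇ p (x ∷ xs) with p x
... | true = cong suc (length-filterᵇ p xs)
... | false = length-filterᵇ p xs

length-filterᵇ-cartesianProduct : {A B : Set} (p : A × B → Bool) (xs : List A) (ys : List B) →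
  length (filterᵇ p (cartesianProduct xs ys)) ≡ sumOver xs (λ a → sumOver ys (λ b → 𝟙 (p (a , b))))
length-filterᵇ-cartesianProduct p [] ys = refl
length-filterᵇ-cartesianProduct p (x ∷ xs) ys = begin
  length (filterᵇ p (map (x ,_) ys ++ cartesianProduct xs ys))
    ≡⟨ length-filterᵇ p (map (x ,_) ys ++ cartesianProduct xs ys) ⟩
  sumOver (map (x ,_) ys ++ cartesianProduct xs ys) (𝟙 ∘ p)
    ≡⟨ sumOver-++ (map (x ,_) ys) _ _ ⟩
  sumOver (map (x ,_) ys) (𝟙 ∘ p) + sumOver (cartesianProduct xs ys) (𝟙 ∘ p)
    ≡⟨ cong₂ _+_ (sumOver-map (x ,_) ys (𝟙 ∘ p)) (sym (length-filterᵇ p (cartesianProduct xs ys))) ⟩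
  sumOver ys (λ b → 𝟙 (p (x , b))) + length (filterᵇ p (cartesianProduct xs ys))
    ≡⟨ cong (_ +_) (length-filterᵇ-cartesianProduct p xs ys) ⟩
  _ ∎

¬T⇒≡false : ∀ {b} → ¬ T b → b ≡ false
¬T⇒≡false {false} _ = refl
¬T⇒≡false {true} ¬t = ⊥-elim (¬t tt)

T⇒≡true : ∀ {b} → T b → b ≡ true
T⇒≡true = Equivalence.to T-≡

≤ᵇ-true : ∀ {m n} → m ≤ n → (m ≤ᵇ n) ≡ true
≤ᵇ-true p = T⇒≡true (≤⇒≤ᵇ p)

≤ᵇ-false : ∀ {m n} → n < m → (m ≤ᵇ n) ≡ false
≤ᵇ-false {m} {n} p = ¬T⇒≡false (<⇒≱ p ∘ ≤ᵇ⇒≤ m n)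

<ᵇ-true : ∀ {m n} → m < n → (m <ᵇ n) ≡ true
<ᵇ-true p = T⇒≡true (<⇒<ᵇ p)

<ᵇ-false : ∀ {m n} → n ≤ m → (m <ᵇ n) ≡ false
<ᵇ-false {m} {n} p = ¬T⇒≡false (λ t → <⇒≱ (<ᵇ⇒< m n t) p)

≡ᵇ-true : ∀ {m n} → m ≡ n → (m ≡ᵇ n) ≡ true
≡ᵇ-true {m} {n} p = T⇒≡true (≡⇒≡ᵇ m n p)

≡ᵇ-false : ∀ {m n} → m ≢ n → (m ≡ᵇ n) ≡ false
≡ᵇ-false {m} {n} p = ¬T⇒≡false (p ∘ ≡ᵇ⇒≡ m n)

≡ᵇ-refl : ∀ m → (m ≡ᵇ m) ≡ true
≡ᵇ-refl m = ≡ᵇ-true {m} refl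

≡ᵇ⇒≡′ : ∀ {m n} → (m ≡ᵇ n) ≡ true → m ≡ n
≡ᵇ⇒≡′ {m} {n} e = ≡ᵇ⇒≡ m n (Equivalence.from T-≡ e)

≡ᵇ-cong-iff : ∀ {a b c d} → (a ≡ b → c ≡ d) → (c ≡ d → a ≡ b) → (a ≡ᵇ b) ≡ (c ≡ᵇ d)
≡ᵇ-cong-iff {a} {b} to from with a ≟ b
... | yes p = trans (≡ᵇ-true p) (sym (≡ᵇ-true (to p)))
... | no ¬p = trans (≡ᵇ-false ¬p) (sym (≡ᵇ-false (¬p ∘ from)))

≡ᵇ-sym : ∀ m n → (m ≡ᵇ n) ≡ (n ≡ᵇ m)
≡ᵇ-sym m n = ≡ᵇ-cong-iff {m} {n} {n} {m} sym sym

∸-≡ : ∀ {a b c} → a ≡ b + c → a ∸ b ≡ c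
∸-≡ {a} {b} {c} refl = m+n∸m≡n b c

-- Differences modulo n

-- diffMod on representatives: diffMod n u w is δ n (toℕ u) (toℕ w) by definition.
δ : ℕ → ℕ → ℕ → ℕ
δ n x y = if x ≤ᵇ y then y ∸ x else (n + y) ∸ x

wrap : Bool → ℕ → ℕ
wrap false n = 0
wrap true n = n

δ-≤ : ∀ n {x y} → x ≤ y → δ n x y ≡ y ∸ x
δ-≤ n p rewrite ≤ᵇ-true p = refl

δ-> : ∀ n {x y} → y < x → δ n x y ≡ n + y ∸ x
δ-> n p rewrite ≤ᵇ-false p = refl

δ-self : ∀ n x → δ n x x ≡ 0
δ-self n x = trans (δ-≤ n {x} {x} ≤-refl) (n∸n≡0 x)

δ-neg : ∀ n x → 0 < x → δ n x 0 ≡ n ∸ x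
δ-neg n x 0<x = trans (δ-> n 0<x) (cong (_∸ x) (+-identityʳ n))

δ-< : ∀ n a b → a < n → b < n → δ n a b < n
δ-< n a b a<n b<n with a ≤? b
... | yes a≤b rewrite δ-≤ n a≤b = ≤-<-trans (m∸n≤m b a) b<n
... | no a≰b rewrite δ-> n (≰⇒> a≰b) =
  +-cancelˡ-< a _ _ (subst (_< a + n) (sym (m+[n∸m]≡n (≤-trans (<⇒≤ a<n) (m≤m+n n b))))
                           (subst (n + b <_) (+-comm n a) (+-monoʳ-< n (≰⇒> a≰b))))

δ-spec : ∀ n a b → a ≤ n → a + δ n a b ≡ b + wrap (b <ᵇ a) n
δ-spec n a b a≤n with ≤-<-connex a b
... | inj₁ a≤b rewrite δ-≤ n a≤b | <ᵇ-false a≤b = trans (m+[n∸m]≡n a≤b) (sym (+-identityʳ b))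
... | inj₂ b<a rewrite δ-> n b<a | <ᵇ-true b<a =
  trans (m+[n∸m]≡n (≤-trans a≤n (m≤m+n n b))) (+-comm n b)

residue-unique : ∀ n p q d d′ i j → d < n → d′ < n →
  p + d ≡ q + wrap i n → p + d′ ≡ q + wrap j n → d ≡ d′
residue-unique n p q d d′ false false _ _ e e′ = +-cancelˡ-≡ p _ _ (trans e (sym e′))
residue-unique n p q d d′ true true _ _ e e′ = +-cancelˡ-≡ p _ _ (trans e (sym e′))
residue-unique n p q d d′ false true d<n d′<n e e′ =
  contradiction d′<n (≤⇒≯ (subst (n ≤_) (sym (+-cancelˡ-≡ p d′ (d + n)
    (trans e′ (trans (cong (_+ n) (sym (trans e (+-identityʳ q)))) (+-assoc p d n))))) (m≤n+m n d)))
residue-unique n p q d d′ true false d<n d′<n e e′ =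
  sym (residue-unique n p q d′ d false true d′<n d<n e′ e)

-- For p, q, r < n the carries in a congruence p + r ≡ q (mod n) reduce to a single one.
carry-reduce : ∀ n p q r i j k → p < n → r < n → q < n →
  p + r + wrap j n ≡ q + wrap k n + wrap i n → Σ Bool (λ e → p + r ≡ q + wrap e n)
carry-reduce n p q r false false false _ _ _ eq =
  false , trans (sym (+-identityʳ (p + r))) (trans eq (+-identityʳ (q + 0)))
carry-reduce n p q r true false false _ _ _ eq =
  true , trans (sym (+-identityʳ (p + r))) (trans eq (cong (_+ n) (+-identityʳ q)))
carry-reduce n p q r false false true _ _ _ eq =
  true , trans (sym (+-identityʳ (p + r))) (trans eq (+-identityʳ (q + n)))
carry-reduce n p q r true false true p<n r<n _ eq = contradiction (+-mono-< p<n r<n) (≤⇒≯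
  (subst (n + n ≤_) (sym (trans (sym (+-identityʳ (p + r))) eq))
         (≤-trans (m≤n+m (n + n) q) (≤-reflexive (sym (+-assoc q n n))))))
carry-reduce n p q r false true false _ _ q<n eq = contradiction q<n (≤⇒≯
  (subst (n ≤_) (trans eq (trans (+-identityʳ (q + 0)) (+-identityʳ q))) (m≤n+m n (p + r))))
carry-reduce n p q r false true true _ _ _ eq =
  false , +-cancelʳ-≡ n (p + r) (q + 0) (trans eq (trans (+-identityʳ (q + n)) (cong (_+ n) (sym (+-identityʳ q)))))
carry-reduce n p q r true true false _ _ _ eq = false , +-cancelʳ-≡ n (p + r) (q + 0) eq
carry-reduce n p q r true true true _ _ _ eq = true , +-cancelʳ-≡ n (p + r) (q + n) eq

-- Adding the defining equations of δ a b and δ b c and comparing with that of δ a c gives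
-- δ a b + δ b c ≡ δ a c (mod n).
δ-translation-invariant : ∀ n a b c → a < n → b < n → c < n → δ n (δ n a b) (δ n a c) ≡ δ n b c
δ-translation-invariant n a b c a<n b<n c<n =
  sym (residue-unique n p q r (δ n p q) e (q <ᵇ p) r<n (δ-< n p q p<n q<n) p+r≡q+e (δ-spec n p q (<⇒≤ p<n)))
  where
  p = δ n a b
  q = δ n a c
  r = δ n b c
  p<n = δ-< n a b a<n b<n
  q<n = δ-< n a c a<n c<n
  r<n = δ-< n b c b<n c<n
  i = b <ᵇ a
  j = c <ᵇ a
  k = c <ᵇ b
  rearrange₁ : ∀ x y z w → x + (y + z + w) ≡ (x + y) + z + w
  rearrange₁ = solve-∀
  rearrange₂ : ∀ x y z w → x + y + z + w ≡ (x + z) + y + w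
  rearrange₂ = solve-∀
  rearrange₃ : ∀ x y z w → x + y + z + w ≡ (x + w) + y + z
  rearrange₃ = solve-∀
  both-sides : a + (p + r + wrap j n) ≡ a + (q + wrap k n + wrap i n)
  both-sides = begin
    a + (p + r + wrap j n)                  ≡⟨ rearrange₁ a p r _ ⟩
    (a + p) + r + wrap j n                  ≡⟨ cong (λ z → z + r + wrap j n) (δ-spec n a b (<⇒≤ a<n)) ⟩
    b + wrap i n + r + wrap j n             ≡⟨ rearrange₂ b _ r _ ⟩
    (b + r) + wrap i n + wrap j n           ≡⟨ cong (λ z → z + wrap i n + wrap j n) (δ-spec n b c (<⇒≤ b<n)) ⟩
    c + wrap k n + wrap i n + wrap j n      ≡⟨ rearrange₃ c _ _ _ ⟩
    (c + wrap j n) + wrap k n + wrap i n    ≡⟨ cong (λ z → z + wrap k n + wrap i n) (sym (δ-spec n a c (<⇒≤ a<n))) ⟩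
    a + q + wrap k n + wrap i n             ≡⟨ sym (rearrange₁ a q _ _) ⟩
    a + (q + wrap k n + wrap i n)           ∎
  reduced = carry-reduce n p q r i j k p<n r<n q<n (+-cancelˡ-≡ a _ _ both-sides)
  e = proj₁ reduced
  p+r≡q+e = proj₂ reduced

sumBelow-translate : ∀ n v (G : ℕ → ℕ) → v ≤ n → sumBelow n (G ∘ δ n v) ≡ sumBelow n G
sumBelow-translate n v G v≤n = begin
  sumBelow n (G ∘ δ n v)
    ≡⟨ cong (λ k → sumBelow k (G ∘ δ n v)) (sym (m+[n∸m]≡n v≤n)) ⟩
  sumBelow (v + m) (G ∘ δ n v)
    ≡⟨ sumBelow-+-range v m _ ⟩
  sumBelow v (G ∘ δ n v) + sumBelow m (λ i → G (δ n v (v + i)))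
    ≡⟨ cong₂ _+_ (sumBelow-cong v (λ a a<v → cong G (trans (δ-> n a<v) (+-∸-comm a v≤n))))
                 (sumBelow-cong m (λ i _ → cong G (trans (δ-≤ n (m≤m+n v i)) (m+n∸m≡n v i)))) ⟩
  sumBelow v (λ a → G (m + a)) + sumBelow m G
    ≡⟨ +-comm _ (sumBelow m G) ⟩
  sumBelow m G + sumBelow v (λ a → G (m + a))
    ≡⟨ sym (sumBelow-+-range m v G) ⟩
  sumBelow (m + v) G
    ≡⟨ cong (λ k → sumBelow k G) (trans (+-comm m v) (m+[n∸m]≡n v≤n)) ⟩
  sumBelow n G ∎
  where
  m = n ∸ v

sumBelow-negate : ∀ n (G : ℕ → ℕ) → sumBelow n (λ x → G (δ n x 0)) ≡ sumBelow n G
sumBelow-negate zero G = refl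
sumBelow-negate (suc m) G = cong (G 0 +_) (begin
  sumBelow m (λ i → G (suc m + 0 ∸ suc i))
    ≡⟨ sumBelow-cong m (λ i i<m → cong G (trans (cong (_∸ suc i) (+-identityʳ (suc m))) (+-∸-assoc 1 i<m))) ⟩
  sumBelow m (λ i → G (suc (m ∸ suc i)))
    ≡⟨ sym (sumBelow-reverse m (G ∘ suc)) ⟩
  sumBelow m (G ∘ suc) ∎)

n+a∸[a+d]≡n∸d : ∀ n a d → n + a ∸ (a + d) ≡ n ∸ d
n+a∸[a+d]≡n∸d n a d = trans (sym (∸-+-assoc (n + a) a d)) (cong (_∸ d) (m+n∸n≡m n a))

δ-swap : ∀ n a b → a < n → b < n → a ≢ b → δ n b a ≡ n ∸ δ n a b
δ-swap n a b a<n b<n a≢b with <-cmp a b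
... | tri< a<b _ _ rewrite δ-≤ n (<⇒≤ a<b) | δ-> n a<b = go (b ∸ a) (sym (m+[n∸m]≡n (<⇒≤ a<b)))
  where
  go : ∀ d → b ≡ a + d → n + a ∸ b ≡ n ∸ (b ∸ a)
  go d refl = trans (n+a∸[a+d]≡n∸d n a d) (cong (n ∸_) (sym (m+n∸m≡n a d)))
... | tri≈ _ e _ = contradiction e a≢b
... | tri> _ _ b<a rewrite δ-≤ n (<⇒≤ b<a) | δ-> n b<a = go (a ∸ b) (sym (m+[n∸m]≡n (<⇒≤ b<a)))
  where
  go : ∀ d → a ≡ b + d → a ∸ b ≡ n ∸ (n + b ∸ a)
  go d refl = trans (m+n∸m≡n b d)
    (trans (sym (m∸[m∸n]≡n (≤-trans (m≤n+m d b) (<⇒≤ a<n)))) (cong (n ∸_) (sym (n+a∸[a+d]≡n∸d n b d))))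

δ-∸ˡ : ∀ n x y → x ≤ n → y < n ∸ x → δ n (n ∸ x) y ≡ y + x
δ-∸ˡ n x y x≤n y<n-x = trans (δ-> n y<n-x) (∸-≡ {b = n ∸ x} (begin
  n + y              ≡⟨ cong (_+ y) (sym (m∸n+n≡m x≤n)) ⟩
  n ∸ x + x + y      ≡⟨ +-assoc (n ∸ x) x y ⟩
  n ∸ x + (x + y)    ≡⟨ cong (n ∸ x +_) (+-comm x y) ⟩
  n ∸ x + (y + x)    ∎))

δ-∸ʳ : ∀ n x y → x ≤ n ∸ y → δ n x (n ∸ y) ≡ n ∸ (y + x)
δ-∸ʳ n x y x≤n-y = trans (δ-≤ n x≤n-y) (∸-+-assoc n y x)

-- Translate by x + y: −x and −y are the translates of y and x.
δ-∸-∸ : ∀ n x y → 0 < x → 0 < y → x + y < n → δ n (n ∸ x) (n ∸ y) ≡ δ n y x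
δ-∸-∸ n x y 0<x 0<y x+y<n = begin
  δ n (n ∸ x) (n ∸ y)              ≡⟨ cong₂ (δ n) (sym at-y) (sym at-x) ⟩
  δ n (δ n (x + y) y) (δ n (x + y) x) ≡⟨ δ-translation-invariant n (x + y) y x x+y<n y<n x<n ⟩
  δ n y x                          ∎
  where
  x<n = ≤-<-trans (m≤m+n x y) x+y<n
  y<n = ≤-<-trans (m≤n+m y x) x+y<n
  at-y : δ n (x + y) y ≡ n ∸ x
  at-y = trans (δ-> n (m<n+m y 0<x)) (trans (cong (n + y ∸_) (+-comm x y)) (n+a∸[a+d]≡n∸d n y x))
  at-x : δ n (x + y) x ≡ n ∸ y
  at-x = trans (δ-> n (m<m+n x 0<y)) (n+a∸[a+d]≡n∸d n x y)

-- Degree and triangles of a circulant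

elemᵇ-false : ∀ x S → All (x ≢_) S → elemᵇ x S ≡ false
elemᵇ-false x [] [] = refl
elemᵇ-false x (s ∷ S) (p ∷ ps) rewrite ≡ᵇ-false p = elemᵇ-false x S ps

elemᵇ-below : ∀ x S → All (x <_) S → elemᵇ x S ≡ false
elemᵇ-below x S = elemᵇ-false x S ∘ All.map <⇒≢

elemᵇ-above : ∀ x S → All (_< x) S → elemᵇ x S ≡ false
elemᵇ-above x S = elemᵇ-false x S ∘ All.map (≢-sym ∘ <⇒≢)

-- d ∈ S ∪ −S in ℤ_n, so that circAdj n S u w ≡ inConn n S (δ n (toℕ u) (toℕ w)) by computation.
inConn : ℕ → List ℕ → ℕ → Bool
inConn n S d = elemᵇ d S ∨ elemᵇ (n ∸ d) S

inConn-neg : ∀ n S d → d ≤ n → inConn n S (n ∸ d) ≡ inConn n S d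
inConn-neg n S d d≤n rewrite m∸[m∸n]≡n d≤n = ∨-comm (elemᵇ (n ∸ d) S) (elemᵇ d S)

inConn-δ-sym : ∀ n S a b → a < n → b < n → inConn n S (δ n a b) ≡ inConn n S (δ n b a)
inConn-δ-sym n S a b a<n b<n with a ≟ b
... | yes refl = refl
... | no a≢b rewrite δ-swap n a b a<n b<n a≢b = sym (inConn-neg n S (δ n a b) (<⇒≤ (δ-< n a b a<n b<n)))

connSize : ℕ → List ℕ → ℕ
connSize n S = sumBelow n (𝟙 ∘ inConn n S)

-- Ordered pairs (x, y) such that 0, x, y span a triangle of Circ(n, S).
triangleCount : ℕ → List ℕ → ℕ
triangleCount n S =
  sumBelow n (λ x → sumBelow n (λ y → 𝟙 (inConn n S x ∧ inConn n S y ∧ inConn n S (δ n x y))))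

degree≡connSize : ∀ n S (v : Fin n) → degree n S v ≡ connSize n S
degree≡connSize n S v = begin
  degree n S v
    ≡⟨ trans (length-filterᵇ _ (allFin n)) (sumOver-tabulate n id _ _ (λ _ → refl)) ⟩
  sumBelow n (𝟙 ∘ inConn n S ∘ δ n (toℕ v))
    ≡⟨ sumBelow-translate n (toℕ v) (𝟙 ∘ inConn n S) (<⇒≤ (toℕ<n v)) ⟩
  connSize n S ∎

twice-sumBelow-< : ∀ n (F : ℕ → ℕ → Bool) →
  (∀ a b → a < n → b < n → F a b ≡ F b a) → (∀ a → a < n → F a a ≡ false) →
  2 * sumBelow n (λ a → sumBelow n (λ b → 𝟙 ((a <ᵇ b) ∧ F a b)))
    ≡ sumBelow n (λ a → sumBelow n (λ b → 𝟙 (F a b)))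
twice-sumBelow-< n F F-sym F-irrefl = sym (begin
  sumBelow n (λ a → sumBelow n (λ b → 𝟙 (F a b)))
    ≡⟨ sumBelow-cong n (λ a a<n → sumBelow-cong n (λ b b<n → split a b a<n b<n)) ⟩
  sumBelow n (λ a → sumBelow n (λ b → X a b + X b a))
    ≡⟨ sumBelow-cong n (λ a _ → sumBelow-+ n (X a) (λ b → X b a)) ⟩
  sumBelow n (λ a → sumBelow n (X a) + sumBelow n (λ b → X b a))
    ≡⟨ sumBelow-+ n _ _ ⟩
  Σ< + sumBelow n (λ a → sumBelow n (λ b → X b a))
    ≡⟨ cong (Σ< +_) (sumBelow-swap n n (λ a b → X b a)) ⟩
  Σ< + Σ<
    ≡⟨ cong (Σ< +_) (sym (+-identityʳ _)) ⟩
  2 * Σ< ∎)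
  where
  X : ℕ → ℕ → ℕ
  X a b = 𝟙 ((a <ᵇ b) ∧ F a b)
  Σ< = sumBelow n (λ a → sumBelow n (X a))
  split : ∀ a b → a < n → b < n → 𝟙 (F a b) ≡ X a b + X b a
  split a b a<n b<n with <-cmp a b
  ... | tri< a<b _ _ rewrite <ᵇ-true a<b | <ᵇ-false (<⇒≤ a<b) = sym (+-identityʳ _)
  ... | tri≈ _ refl _ rewrite <ᵇ-false (≤-refl {a}) | F-irrefl a a<n = refl
  ... | tri> _ _ b<a rewrite <ᵇ-true b<a | <ᵇ-false (<⇒≤ b<a) = cong 𝟙 (F-sym a b a<n b<n)

twice-eNbhd≡triangleCount : ∀ n S (v : Fin n) → inConn n S 0 ≡ false → 2 * eNbhd n S v ≡ triangleCount n S
twice-eNbhd≡triangleCount n S v 0∉conn = begin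
  2 * eNbhd n S v
    ≡⟨ cong (2 *_) (trans (length-filterᵇ-cartesianProduct _ (allFin n) (allFin n))
                         (sumOver-tabulate n id _ _ (λ a → sumOver-tabulate n id _ _ (λ b → refl)))) ⟩
  2 * sumBelow n (λ a → sumBelow n (λ b → 𝟙 ((a <ᵇ b) ∧ F a b)))
    ≡⟨ twice-sumBelow-< n F F-sym F-irrefl ⟩
  sumBelow n (λ a → sumBelow n (λ b → 𝟙 (F a b)))
    ≡⟨ sumBelow-cong n (λ a a<n → sumBelow-cong n (λ b b<n →
         cong (λ z → 𝟙 (A (δ n v′ a) ∧ A (δ n v′ b) ∧ A z))
              (sym (δ-translation-invariant n v′ a b v′<n a<n b<n)))) ⟩
  sumBelow n (λ a → sumBelow n (H (δ n v′ a) ∘ δ n v′))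
    ≡⟨ sumBelow-cong n (λ a _ → sumBelow-translate n v′ (H (δ n v′ a)) (<⇒≤ v′<n)) ⟩
  sumBelow n (λ a → sumBelow n (H (δ n v′ a)))
    ≡⟨ sumBelow-translate n v′ (λ x → sumBelow n (H x)) (<⇒≤ v′<n) ⟩
  triangleCount n S ∎
  where
  v′ = toℕ v
  v′<n = toℕ<n v
  A = inConn n S
  F : ℕ → ℕ → Bool
  F a b = A (δ n v′ a) ∧ A (δ n v′ b) ∧ A (δ n a b)
  H : ℕ → ℕ → ℕ
  H x y = 𝟙 (A x ∧ A y ∧ A (δ n x y))
  F-sym : ∀ a b → a < n → b < n → F a b ≡ F b a
  F-sym a b a<n b<n rewrite inConn-δ-sym n S a b a<n b<n with A (δ n v′ a) | A (δ n v′ b)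
  ... | true | true = refl
  ... | true | false = refl
  ... | false | true = refl
  ... | false | false = refl
  F-irrefl : ∀ a → a < n → F a a ≡ false
  F-irrefl a _ rewrite δ-self n a | 0∉conn = trans (cong (A (δ n v′ a) ∧_) (∧-zeroʳ _)) (∧-zeroʳ _)

-- Part (a): the order-three symmetry of triangles

isMinOf3 : ℕ → ℕ → ℕ → Bool
isMinOf3 a b c = (a <ᵇ b) ∧ (a <ᵇ c)

minCount : ℕ → ℕ → ℕ → ℕ
minCount a b c = 𝟙 (isMinOf3 a b c) + 𝟙 (isMinOf3 b c a) + 𝟙 (isMinOf3 c a b)

minCount-rotate : ∀ a b c → minCount a b c ≡ minCount b c a
minCount-rotate a b c = rotate₃ (𝟙 (isMinOf3 a b c)) _ _
  where
  rotate₃ : ∀ x y z → x + y + z ≡ y + z + x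
  rotate₃ = solve-∀

minCount-of-min : ∀ {a b c} → a < b → a < c → minCount a b c ≡ 1
minCount-of-min {a} {b} {c} a<b a<c
  rewrite <ᵇ-true a<b | <ᵇ-true a<c | <ᵇ-false (<⇒≤ a<b) | <ᵇ-false (<⇒≤ a<c) | ∧-zeroʳ (b <ᵇ c) = refl

minCount-distinct : ∀ a b c → a ≢ b → b ≢ c → a ≢ c → minCount a b c ≡ 1
minCount-distinct a b c a≢b b≢c a≢c with <-cmp a b | <-cmp a c | <-cmp b c
... | tri≈ _ e _ | _ | _ = contradiction e a≢b
... | _ | tri≈ _ e _ | _ = contradiction e a≢c
... | _ | _ | tri≈ _ e _ = contradiction e b≢c
... | tri< a<b _ _ | tri< a<c _ _ | _ = minCount-of-min a<b a<c
... | _ | tri> _ _ c<a | tri> _ _ c<b =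
  trans (minCount-rotate a b c) (trans (minCount-rotate b c a) (minCount-of-min c<a c<b))
... | tri> _ _ b<a | _ | tri< b<c _ _ = trans (minCount-rotate a b c) (minCount-of-min b<c b<a)
... | tri< a<b _ _ | tri> _ _ c<a | tri< b<c _ _ = contradiction (<-trans a<b b<c) (<-asym c<a)
... | tri> _ _ b<a | tri< a<c _ _ | tri> _ _ c<b = contradiction (<-trans a<c c<b) (<-asym b<a)

module Rotation (n : ℕ) where

  Pair : Set
  Pair = ℕ × ℕ

  rot : Pair → Pair
  rot (x , y) = δ n x y , δ n x 0

  InRange : Pair → Set
  InRange (x , y) = x < n × y < n

  sumPairs : (Pair → ℕ) → ℕ
  sumPairs h = sumBelow n (λ x → sumBelow n (λ y → h (x , y)))

  sumPairs-cong : ∀ {h h′ : Pair → ℕ} → (∀ p → InRange p → h p ≡ h′ p) → sumPairs h ≡ sumPairs h′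
  sumPairs-cong e = sumBelow-cong n (λ x x<n → sumBelow-cong n (λ y y<n → e (x , y) (x<n , y<n)))

  sumPairs-+ : ∀ (h h′ : Pair → ℕ) → sumPairs (λ p → h p + h′ p) ≡ sumPairs h + sumPairs h′
  sumPairs-+ h h′ =
    trans (sumBelow-cong n (λ x _ → sumBelow-+ n (λ y → h (x , y)) (λ y → h′ (x , y)))) (sumBelow-+ n _ _)

  sumPairs-rot : ∀ h → sumPairs (h ∘ rot) ≡ sumPairs h
  sumPairs-rot h = begin
    sumBelow n (λ x → sumBelow n (λ y → h (δ n x y , δ n x 0)))
      ≡⟨ sumBelow-cong n (λ x x<n → sumBelow-translate n x (λ y → h (y , δ n x 0)) (<⇒≤ x<n)) ⟩
    sumBelow n (λ x → sumBelow n (λ y → h (y , δ n x 0)))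
      ≡⟨ sumBelow-swap n n _ ⟩
    sumBelow n (λ y → sumBelow n (λ x → h (y , δ n x 0)))
      ≡⟨ sumBelow-cong n (λ y _ → sumBelow-negate n (λ x → h (y , x))) ⟩
    sumPairs h ∎

  rot-InRange : ∀ p → InRange p → InRange (rot p)
  rot-InRange (x , y) (x<n , y<n) = δ-< n x y x<n y<n , δ-< n x 0 x<n (≤-<-trans z≤n x<n)

  rot²≡ : ∀ x y → x < n → y < n → rot (rot (x , y)) ≡ (δ n y 0 , δ n y x)
  rot²≡ x y x<n y<n = cong₂ _,_ (δ-translation-invariant n x y 0 x<n y<n 0<n)
    (trans (cong (δ n (δ n x y)) (sym (δ-self n x))) (δ-translation-invariant n x y x x<n y<n x<n))
    where 0<n = ≤-<-trans z≤n x<n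

  rot³≡id : ∀ p → InRange p → rot (rot (rot p)) ≡ p
  rot³≡id (x , y) (x<n , y<n) = trans (cong rot (rot²≡ x y x<n y<n))
    (cong₂ _,_ (δ-translation-invariant n y 0 x y<n 0<n x<n)
               (trans (cong (δ n (δ n y 0)) (sym (δ-self n y))) (δ-translation-invariant n y 0 y y<n 0<n y<n)))
    where 0<n = ≤-<-trans z≤n x<n

  rot-injective : ∀ p q → InRange p → InRange q → rot p ≡ rot q → p ≡ q
  rot-injective p q rp rq e = trans (sym (rot³≡id p rp)) (trans (cong (rot ∘ rot) e) (rot³≡id q rq))

  isFixed : Pair → Bool
  isFixed (x , y) = (x ≡ᵇ δ n x y) ∧ (y ≡ᵇ δ n x 0)

  isFixed-true : ∀ p → isFixed p ≡ true → p ≡ rot p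
  isFixed-true (x , y) e with x ≡ᵇ δ n x y in e₁ | y ≡ᵇ δ n x 0 in e₂
  ... | true | true = cong₂ _,_ (≡ᵇ⇒≡′ e₁) (≡ᵇ⇒≡′ e₂)

  isFixed-false : ∀ p → isFixed p ≡ false → p ≢ rot p
  isFixed-false (x , y) e p≡rot with x ≡ᵇ δ n x y in e₁ | y ≡ᵇ δ n x 0 in e₂
  ... | false | _ = subst T e₁ (≡⇒≡ᵇ _ _ (cong proj₁ p≡rot))
  ... | true | false = subst T e₂ (≡⇒≡ᵇ _ _ (cong proj₂ p≡rot))

  isFixed-of : ∀ p → p ≡ rot p → isFixed p ≡ true
  isFixed-of p e = cong₂ _∧_ (≡ᵇ-true (cong proj₁ e)) (≡ᵇ-true (cong proj₂ e))

  isFixed-rot : ∀ p → InRange p → isFixed (rot p) ≡ isFixed p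
  isFixed-rot p r with isFixed p in e
  ... | true = isFixed-of (rot p) (cong rot (isFixed-true p e))
  ... | false with isFixed (rot p) in e′
  ...   | false = refl
  ...   | true = contradiction (rot-injective p (rot p) r (rot-InRange p r) (isFixed-true (rot p) e′))
                               (isFixed-false p e)

  -- Any injective numbering of the pairs singles out one element of each orbit of size three.
  code : Pair → ℕ
  code (x , y) = x * n + y

  code-injective : ∀ p q → InRange p → InRange q → code p ≡ code q → p ≡ q
  code-injective (x , y) (x′ , y′) (_ , y<n) (_ , y′<n) e with <-cmp x x′
  ... | tri< lt _ _ = contradiction
        (≤-trans (≤-reflexive (+-comm (x * n) n)) (≤-trans (*-monoˡ-≤ n lt) (≤-trans (m≤m+n (x′ * n) y′) (≤-reflexive (sym e)))))
        (<⇒≱ (+-monoʳ-< (x * n) y<n))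
  ... | tri≈ _ refl _ = cong (x ,_) (+-cancelˡ-≡ (x * n) y y′ e)
  ... | tri> _ _ gt = contradiction
        (≤-trans (≤-reflexive (+-comm (x′ * n) n)) (≤-trans (*-monoˡ-≤ n gt) (≤-trans (m≤m+n (x * n) y) (≤-reflexive e))))
        (<⇒≱ (+-monoʳ-< (x′ * n) y′<n))

  isOrbitMin : Pair → Bool
  isOrbitMin p = isMinOf3 (code p) (code (rot p)) (code (rot (rot p)))

  orbit-one-min : ∀ p → InRange p → isFixed p ≡ false →
    𝟙 (isOrbitMin p) + 𝟙 (isOrbitMin (rot p)) + 𝟙 (isOrbitMin (rot (rot p))) ≡ 1
  orbit-one-min p r nonfixed =
    trans (cong₂ (λ u v → 𝟙 (isOrbitMin p) + 𝟙 (isMinOf3 (code (rot p)) (code (rot (rot p))) (code u))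
                            + 𝟙 (isMinOf3 (code (rot (rot p))) (code u) (code v)))
                 (rot³≡id p r) (cong rot (rot³≡id p r)))
          (minCount-distinct (code p) (code (rot p)) (code (rot (rot p)))
             (code-distinct p (rot p) r r₁ p≢rp) (code-distinct (rot p) (rot (rot p)) r₁ r₂ rp≢rrp)
             (code-distinct p (rot (rot p)) r r₂ p≢rrp))
    where
    r₁ = rot-InRange p r
    r₂ = rot-InRange (rot p) r₁
    p≢rp : p ≢ rot p
    p≢rp = isFixed-false p nonfixed
    rp≢rrp : rot p ≢ rot (rot p)
    rp≢rrp e = p≢rp (rot-injective p (rot p) r r₁ e)
    p≢rrp : p ≢ rot (rot p)
    p≢rrp e = p≢rp (trans (sym (rot³≡id p r)) (cong rot (sym e)))
    code-distinct : ∀ q q′ → InRange q → InRange q′ → q ≢ q′ → code q ≢ code q′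
    code-distinct q q′ rq rq′ q≢q′ = q≢q′ ∘ code-injective q q′ rq rq′

  orbit-decomposition : ∀ (f : Pair → ℕ) → (∀ p → InRange p → f (rot p) ≡ f p) →
    sumPairs f ≡ sumPairs (λ p → f p * 𝟙 (isFixed p))
                 + 3 * sumPairs (λ p → f p * 𝟙 (not (isFixed p)) * 𝟙 (isOrbitMin p))
  orbit-decomposition f f-rot = begin
    sumPairs f
      ≡⟨ sumPairs-cong split ⟩
    sumPairs (λ p → fixedPart p + (orbitPart p + (g p * m (rot p) + g p * m (rot (rot p)))))
      ≡⟨ sumPairs-+ fixedPart _ ⟩
    Σfixed + sumPairs (λ p → orbitPart p + (g p * m (rot p) + g p * m (rot (rot p))))
      ≡⟨ cong (Σfixed +_) (sumPairs-+ orbitPart _) ⟩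
    Σfixed + (Σorbit + sumPairs (λ p → g p * m (rot p) + g p * m (rot (rot p))))
      ≡⟨ cong (λ z → Σfixed + (Σorbit + z)) (sumPairs-+ _ _) ⟩
    Σfixed + (Σorbit + (sumPairs (λ p → g p * m (rot p)) + sumPairs (λ p → g p * m (rot (rot p)))))
      ≡⟨ cong (λ z → Σfixed + (Σorbit + z)) (cong₂ _+_ shifted₁ shifted₂) ⟩
    Σfixed + (Σorbit + (Σorbit + Σorbit))
      ≡⟨ cong (λ z → Σfixed + (Σorbit + (Σorbit + z))) (sym (+-identityʳ Σorbit)) ⟩
    Σfixed + 3 * Σorbit ∎
    where
    m : Pair → ℕ
    m = 𝟙 ∘ isOrbitMin
    g : Pair → ℕ
    g p = f p * 𝟙 (not (isFixed p))
    fixedPart orbitPart : Pair → ℕ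
    fixedPart p = f p * 𝟙 (isFixed p)
    orbitPart p = g p * m p
    Σfixed = sumPairs fixedPart
    Σorbit = sumPairs orbitPart
    g-rot : ∀ p → InRange p → g (rot p) ≡ g p
    g-rot p r = cong₂ (λ u v → u * 𝟙 (not v)) (f-rot p r) (isFixed-rot p r)
    split : ∀ p → InRange p → f p ≡ fixedPart p + (orbitPart p + (g p * m (rot p) + g p * m (rot (rot p))))
    split p r with isFixed p in fixed
    ... | true = ring (f p) (m p) (m (rot p)) (m (rot (rot p)))
      where
      ring : ∀ a b c d → a ≡ a * 1 + (a * 0 * b + (a * 0 * c + a * 0 * d))
      ring = solve-∀
    ... | false = sym (trans (ring (f p) (m p) (m (rot p)) (m (rot (rot p))))
                             (trans (cong (f p *_) (orbit-one-min p r fixed)) (*-identityʳ (f p))))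
      where
      ring : ∀ a b c d → a * 0 + (a * 1 * b + (a * 1 * c + a * 1 * d)) ≡ a * (b + c + d)
      ring = solve-∀
    shifted₁ : sumPairs (λ p → g p * m (rot p)) ≡ Σorbit
    shifted₁ = trans (sumPairs-cong (λ p r → cong (_* m (rot p)) (sym (g-rot p r)))) (sumPairs-rot orbitPart)
    shifted₂ : sumPairs (λ p → g p * m (rot (rot p))) ≡ Σorbit
    shifted₂ = trans (sumPairs-cong (λ p r → cong (_* m (rot (rot p)))
                                      (sym (trans (g-rot (rot p) (rot-InRange p r)) (g-rot p r)))))
                     (trans (sumPairs-rot (orbitPart ∘ rot)) (sumPairs-rot orbitPart))

sumBelow-two-points : ∀ n a b (g : ℕ → ℕ) → a < n → b < n → a ≢ b →
  (∀ x → x < n → x ≢ a → x ≢ b → g x ≡ 0) → sumBelow n g ≡ g a + g b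
sumBelow-two-points n a b g a<n b<n a≢b elsewhere = begin
  sumBelow n g
    ≡⟨ sumBelow-cong n split ⟩
  sumBelow n (λ x → 𝟙 (x ≡ᵇ a) * g x + 𝟙 (x ≡ᵇ b) * g x)
    ≡⟨ sumBelow-+ n _ _ ⟩
  sumBelow n (λ x → 𝟙 (x ≡ᵇ a) * g x) + sumBelow n (λ x → 𝟙 (x ≡ᵇ b) * g x)
    ≡⟨ cong₂ _+_ (sumBelow-delta n a g a<n) (sumBelow-delta n b g b<n) ⟩
  g a + g b ∎
  where
  ring₁ : ∀ z → z ≡ 1 * z + 0 * z
  ring₁ = solve-∀
  ring₂ : ∀ z → z ≡ 0 * z + 1 * z
  ring₂ = solve-∀
  split : ∀ x → x < n → g x ≡ 𝟙 (x ≡ᵇ a) * g x + 𝟙 (x ≡ᵇ b) * g x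
  split x x<n with x ≟ a | x ≟ b
  ... | yes refl | _ rewrite ≡ᵇ-refl x | ≡ᵇ-false a≢b = ring₁ (g x)
  ... | no x≢a | yes refl rewrite ≡ᵇ-refl x | ≡ᵇ-false x≢a = ring₂ (g x)
  ... | no x≢a | no x≢b rewrite ≡ᵇ-false x≢a | ≡ᵇ-false x≢b | elsewhere x x<n x≢a x≢b = refl

3*x≡x+x+x : ∀ x → 3 * x ≡ x + x + x
3*x≡x+x+x = solve-∀

-- A fixed point of the rotation has x = −x − x, so 3x ≡ 0 (mod n).
triple-of-fixed : ∀ n x → x < n → x ≡ δ n x (n ∸ x) → 3 * x ≡ n ⊎ 3 * x ≡ 2 * n
triple-of-fixed n x x<n fixed with x ≤? n ∸ x
... | yes x≤n-x = inj₁ (begin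
  3 * x                  ≡⟨ 3*x≡x+x+x x ⟩
  x + x + x              ≡⟨ cong (λ z → z + x + x) (trans fixed (δ-≤ n x≤n-x)) ⟩
  n ∸ x ∸ x + x + x      ≡⟨ cong (_+ x) (m∸n+n≡m x≤n-x) ⟩
  n ∸ x + x              ≡⟨ m∸n+n≡m (<⇒≤ x<n) ⟩
  n ∎)
... | no x≰n-x = inj₂ (begin
  3 * x                        ≡⟨ 3*x≡x+x+x x ⟩
  x + x + x                    ≡⟨ cong (λ z → z + x + x) (trans fixed (δ-> n (≰⇒> x≰n-x))) ⟩
  n + (n ∸ x) ∸ x + x + x      ≡⟨ cong (_+ x) (m∸n+n≡m (≤-trans (<⇒≤ x<n) (m≤m+n n (n ∸ x)))) ⟩
  n + (n ∸ x) + x              ≡⟨ +-assoc n (n ∸ x) x ⟩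
  n + (n ∸ x + x)              ≡⟨ cong (n +_) (m∸n+n≡m (<⇒≤ x<n)) ⟩
  n + n                        ≡⟨ cong (n +_) (sym (+-identityʳ n)) ⟩
  2 * n ∎)

δ-thirds : ∀ q → 0 < q →
  δ (3 * q) q 0 ≡ 2 * q × δ (3 * q) q (2 * q) ≡ q × δ (3 * q) (2 * q) 0 ≡ q × δ (3 * q) (2 * q) q ≡ 2 * q
δ-thirds q 0<q =
    trans (δ-> (3 * q) {q} {0} 0<q) (∸-≡ {b = q} (ring₁ q))
  , trans (δ-≤ (3 * q) q≤2q) (∸-≡ {b = q} (ring₂ q))
  , trans (δ-> (3 * q) {2 * q} {0} (<-≤-trans 0<q q≤2q)) (∸-≡ {b = 2 * q} (ring₃ q))
  , trans (δ-> (3 * q) {2 * q} {q} (<-≤-trans (m<m+n q 0<q) (≤-reflexive (sym (ring₂ q)))))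
          (∸-≡ {b = 2 * q} (ring₄ q))
  where
  q≤2q : q ≤ 2 * q
  q≤2q = m≤m+n q (q + 0)
  ring₁ : ∀ q → 3 * q + 0 ≡ q + 2 * q
  ring₁ = solve-∀
  ring₂ : ∀ q → 2 * q ≡ q + q
  ring₂ = solve-∀
  ring₃ : ∀ q → 3 * q + 0 ≡ 2 * q + q
  ring₃ = solve-∀
  ring₄ : ∀ q → 3 * q + q ≡ 2 * q + 2 * q
  ring₄ = solve-∀

∧-repeat : ∀ a b → (a ∧ b ∧ a) ≡ (a ∧ b)
∧-repeat true b = ∧-identityʳ b
∧-repeat false b = refl

module TriangleCount (n : ℕ) (S : List ℕ) (0<n : 0 < n) (0∉conn : inConn n S 0 ≡ false) where
  open Rotation n

  A : ℕ → Bool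
  A = inConn n S

  triangle : Pair → ℕ
  triangle (x , y) = 𝟙 (A x ∧ A y ∧ A (δ n x y))

  A-neg : ∀ x → x < n → A (δ n x 0) ≡ A x
  A-neg x x<n = inConn-δ-sym n S x 0 x<n 0<n

  triangle-rot : ∀ p → InRange p → triangle (rot p) ≡ triangle p
  triangle-rot (x , y) (x<n , y<n) = cong 𝟙 (begin
    A (δ n x y) ∧ A (δ n x 0) ∧ A (δ n (δ n x y) (δ n x 0))
      ≡⟨ cong₂ (λ u v → A (δ n x y) ∧ u ∧ v) (A-neg x x<n)
               (trans (cong A (δ-translation-invariant n x y 0 x<n y<n 0<n)) (A-neg y y<n)) ⟩
    A (δ n x y) ∧ A x ∧ A y
      ≡⟨ trans (∧-comm (A (δ n x y)) _) (∧-assoc (A x) (A y) _) ⟩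
    A x ∧ A y ∧ A (δ n x y) ∎)

  fixedRow : ℕ → ℕ
  fixedRow x = triangle (x , δ n x 0) * 𝟙 (x ≡ᵇ δ n x (δ n x 0))

  sum-fixed-row : ∀ x → x < n → sumBelow n (λ y → triangle (x , y) * 𝟙 (isFixed (x , y))) ≡ fixedRow x
  sum-fixed-row x x<n = trans (sumBelow-cong n (λ y _ → reorder y))
    (sumBelow-delta n (δ n x 0) (λ y → triangle (x , y) * 𝟙 (x ≡ᵇ δ n x y)) (δ-< n x 0 x<n 0<n))
    where
    ring : ∀ a b c → a * (b * c) ≡ c * (a * b)
    ring = solve-∀
    reorder : ∀ y → triangle (x , y) * 𝟙 (isFixed (x , y))
                  ≡ 𝟙 (y ≡ᵇ δ n x 0) * (triangle (x , y) * 𝟙 (x ≡ᵇ δ n x y))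
    reorder y = trans (cong (triangle (x , y) *_) (𝟙-∧ (x ≡ᵇ δ n x y) (y ≡ᵇ δ n x 0)))
                      (ring (triangle (x , y)) (𝟙 (x ≡ᵇ δ n x y)) (𝟙 (y ≡ᵇ δ n x 0)))

  fixedRow-zero : ∀ x → x < n → 3 * x ≢ n → 3 * x ≢ 2 * n → fixedRow x ≡ 0
  fixedRow-zero zero _ _ _ rewrite 0∉conn = refl
  fixedRow-zero x@(suc _) x<n ≢n ≢2n with x ≡ᵇ δ n x (δ n x 0) in fixed
  ... | false = *-zeroʳ (triangle (x , δ n x 0))
  ... | true with triple-of-fixed n x x<n (trans (≡ᵇ⇒≡′ fixed) (cong (δ n x) (δ-neg n x z<s)))
  ...   | inj₁ e = contradiction e ≢n
  ...   | inj₂ e = contradiction e ≢2n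

  fixedSum : ℕ
  fixedSum = sumPairs (λ p → triangle p * 𝟙 (isFixed p))

  fixedSum≡ : fixedSum ≡ sumBelow n fixedRow
  fixedSum≡ = sumBelow-cong n sum-fixed-row

  fixedSum-3∤n : ¬ 3 ∣ n → fixedSum ≡ 0
  fixedSum-3∤n 3∤n = trans fixedSum≡ (sumBelow-zero n fixedRow (λ x x<n →
    fixedRow-zero x x<n (3∤n ∘ thrice x) (3∤n ∘ thrice (n ∸ x) ∘ twice-third x)))
    where
    thrice : ∀ m → 3 * m ≡ n → 3 ∣ n
    thrice m e = divides m (trans (sym e) (*-comm 3 m))
    ring : ∀ n → 3 * n ≡ 2 * n + n
    ring = solve-∀
    twice-third : ∀ x → 3 * x ≡ 2 * n → 3 * (n ∸ x) ≡ n
    twice-third x e = trans (*-distribˡ-∸ 3 n x) (trans (cong (3 * n ∸_) e) (∸-≡ (ring n)))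

  module _ (q : ℕ) (3q≡n : 3 * q ≡ n) where

    0<q : 0 < q
    0<q = n≢0⇒n>0 (λ q≡0 → n>0⇒n≢0 0<n (trans (sym 3q≡n) (cong (3 *_) q≡0)))

    values : δ n q 0 ≡ 2 * q × δ n q (2 * q) ≡ q × δ n (2 * q) 0 ≡ q × δ n (2 * q) q ≡ 2 * q
    values = subst (λ m → δ m q 0 ≡ 2 * q × δ m q (2 * q) ≡ q × δ m (2 * q) 0 ≡ q × δ m (2 * q) q ≡ 2 * q)
                   3q≡n (δ-thirds q 0<q)

    fixedRow-q : fixedRow q ≡ 𝟙 (A q ∧ A (2 * q))
    fixedRow-q = begin
      triangle (q , δ n q 0) * 𝟙 (q ≡ᵇ δ n q (δ n q 0))
        ≡⟨ cong (λ z → triangle (q , z) * 𝟙 (q ≡ᵇ δ n q z)) (proj₁ values) ⟩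
      𝟙 (A q ∧ A (2 * q) ∧ A (δ n q (2 * q))) * 𝟙 (q ≡ᵇ δ n q (2 * q))
        ≡⟨ cong (λ z → 𝟙 (A q ∧ A (2 * q) ∧ A z) * 𝟙 (q ≡ᵇ z)) (proj₁ (proj₂ values)) ⟩
      𝟙 (A q ∧ A (2 * q) ∧ A q) * 𝟙 (q ≡ᵇ q)
        ≡⟨ cong₂ (λ a b → 𝟙 a * 𝟙 b) (∧-repeat (A q) (A (2 * q))) (≡ᵇ-refl q) ⟩
      𝟙 (A q ∧ A (2 * q)) * 1
        ≡⟨ *-identityʳ _ ⟩
      𝟙 (A q ∧ A (2 * q)) ∎

    fixedRow-2q : fixedRow (2 * q) ≡ 𝟙 (A q ∧ A (2 * q))
    fixedRow-2q = begin
      triangle (2 * q , δ n (2 * q) 0) * 𝟙 (2 * q ≡ᵇ δ n (2 * q) (δ n (2 * q) 0))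
        ≡⟨ cong (λ z → triangle (2 * q , z) * 𝟙 (2 * q ≡ᵇ δ n (2 * q) z)) (proj₁ (proj₂ (proj₂ values))) ⟩
      𝟙 (A (2 * q) ∧ A q ∧ A (δ n (2 * q) q)) * 𝟙 (2 * q ≡ᵇ δ n (2 * q) q)
        ≡⟨ cong (λ z → 𝟙 (A (2 * q) ∧ A q ∧ A z) * 𝟙 (2 * q ≡ᵇ z)) (proj₂ (proj₂ (proj₂ values))) ⟩
      𝟙 (A (2 * q) ∧ A q ∧ A (2 * q)) * 𝟙 (2 * q ≡ᵇ 2 * q)
        ≡⟨ cong₂ (λ a b → 𝟙 a * 𝟙 b) (trans (∧-repeat (A (2 * q)) (A q)) (∧-comm (A (2 * q)) (A q)))
                 (≡ᵇ-refl (2 * q)) ⟩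
      𝟙 (A q ∧ A (2 * q)) * 1
        ≡⟨ *-identityʳ _ ⟩
      𝟙 (A q ∧ A (2 * q)) ∎

    fixedSum-3∣n : fixedSum ≡ 2 * 𝟙 (A q ∧ A (2 * q))
    fixedSum-3∣n = begin
      fixedSum
        ≡⟨ fixedSum≡ ⟩
      sumBelow n fixedRow
        ≡⟨ sumBelow-two-points n q (2 * q) fixedRow q<n 2q<n q≢2q elsewhere ⟩
      fixedRow q + fixedRow (2 * q)
        ≡⟨ cong₂ _+_ fixedRow-q fixedRow-2q ⟩
      𝟙 (A q ∧ A (2 * q)) + 𝟙 (A q ∧ A (2 * q))
        ≡⟨ cong (𝟙 (A q ∧ A (2 * q)) +_) (sym (+-identityʳ _)) ⟩
      2 * 𝟙 (A q ∧ A (2 * q)) ∎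
      where
      ring₁ : ∀ q → 3 * q ≡ q + 2 * q
      ring₁ = solve-∀
      ring₂ : ∀ q → 3 * q ≡ 2 * q + q
      ring₂ = solve-∀
      ring₃ : ∀ q → 2 * (3 * q) ≡ 3 * (2 * q)
      ring₃ = solve-∀
      ring₄ : ∀ q → 2 * q ≡ q + q
      ring₄ = solve-∀
      q<n : q < n
      q<n = subst (q <_) (trans (sym (ring₁ q)) 3q≡n) (m<m+n q (<-≤-trans 0<q (m≤m+n q (q + 0))))
      2q<n : 2 * q < n
      2q<n = subst (2 * q <_) (trans (sym (ring₂ q)) 3q≡n) (m<m+n (2 * q) 0<q)
      q≢2q : q ≢ 2 * q
      q≢2q e = <-irrefl (trans e (ring₄ q)) (m<m+n q 0<q)
      elsewhere : ∀ x → x < n → x ≢ q → x ≢ 2 * q → fixedRow x ≡ 0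
      elsewhere x x<n x≢q x≢2q = fixedRow-zero x x<n
        (λ e → x≢q (*-cancelˡ-≡ x q 3 (trans e (sym 3q≡n))))
        (λ e → x≢2q (*-cancelˡ-≡ x (2 * q) 3 (trans e (trans (cong (2 *_) (sym 3q≡n)) (ring₃ q)))))

  fixed-sum : Σ Bool λ β → fixedSum ≡ 2 * 𝟙 β
  fixed-sum with 3 ∣? n
  ... | no 3∤n = false , fixedSum-3∤n 3∤n
  ... | yes (divides q n≡q*3) = A q ∧ A (2 * q) , fixedSum-3∣n q (trans (*-comm 3 q) (sym n≡q*3))

  triangleCount-mod3 : Σ Bool λ β → Σ ℕ λ X → triangleCount n S ≡ 2 * 𝟙 β + 3 * X
  triangleCount-mod3 = proj₁ fixed-sum , X ,
    trans (orbit-decomposition triangle triangle-rot) (cong (_+ 3 * X) (proj₂ fixed-sum))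
    where
    X = sumPairs (λ p → triangle p * 𝟙 (not (isFixed p)) * 𝟙 (isOrbitMin p))

valid⇒0∉conn : ∀ n S → 2 ≤ n → ValidJumps n S → inConn n S 0 ≡ false
valid⇒0∉conn n S 2≤n valid = cong₂ _∨_
  (elemᵇ-false 0 S (All.map (λ (1≤s , _) 0≡s → <-irrefl 0≡s 1≤s) valid))
  (elemᵇ-false n S (All.map (λ (_ , s≤n/2) n≡s → <-irrefl (sym n≡s) (≤-<-trans s≤n/2 n/2<n)) valid))
  where
  n/2<n : n / 2 < n
  n/2<n = m/n<m n 2 {{>-nonZero (<-≤-trans z<s 2≤n)}} ≤-refl

%3≢2-if-double≡2β+3X : ∀ c β X → 2 * c ≡ 2 * 𝟙 β + 3 * X → c % 3 ≢ 2
%3≢2-if-double≡2β+3X c β X 2c≡ c%3≡2 = residue β (begin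
  1                          ≡⟨ sym (2c%3≡1) ⟩
  (2 * c) % 3                ≡⟨ cong (_% 3) 2c≡ ⟩
  (2 * 𝟙 β + 3 * X) % 3      ≡⟨ cong (λ z → (2 * 𝟙 β + z) % 3) (*-comm 3 X) ⟩
  (2 * 𝟙 β + X * 3) % 3      ≡⟨ [m+kn]%n≡m%n (2 * 𝟙 β) X 3 ⟩
  (2 * 𝟙 β) % 3              ∎)
  where
  q = c / 3
  ring : ∀ q → 2 * (2 + q * 3) ≡ 4 + (2 * q) * 3
  ring = solve-∀
  2c%3≡1 : (2 * c) % 3 ≡ 1
  2c%3≡1 = begin
    (2 * c) % 3                 ≡⟨ cong (λ z → (2 * z) % 3) (trans (m≡m%n+[m/n]*n c 3) (cong (_+ q * 3) c%3≡2)) ⟩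
    (2 * (2 + q * 3)) % 3       ≡⟨ cong (_% 3) (ring q) ⟩
    (4 + (2 * q) * 3) % 3       ≡⟨ [m+kn]%n≡m%n 4 (2 * q) 3 ⟩
    1                           ∎
  residue : ∀ β → 1 ≢ (2 * 𝟙 β) % 3
  residue true ()
  residue false ()

no-circulant-with-c≡2-mod-3 : ∀ n S r c → 2 ≤ n → ValidJumps n S → IsRCCirc n S r c → c % 3 ≢ 2
no-circulant-with-c≡2-mod-3 n S r c 2≤n valid isRC = %3≢2-if-double≡2β+3X c β X (begin
  2 * c                    ≡⟨ cong (2 *_) (sym (proj₂ (isRC v))) ⟩
  2 * eNbhd n S v          ≡⟨ twice-eNbhd≡triangleCount n S v 0∉conn ⟩
  triangleCount n S        ≡⟨ proj₂ (proj₂ mod3) ⟩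
  2 * 𝟙 β + 3 * X          ∎)
  where
  0<n = <-≤-trans z<s 2≤n
  v : Fin n
  v = fromℕ< 0<n
  0∉conn = valid⇒0∉conn n S 2≤n valid
  mod3 = TriangleCount.triangleCount-mod3 n S 0<n 0∉conn
  β = proj₁ mod3
  X = proj₁ (proj₂ mod3)

-- Distinct lists and Schur counts

Distinct : List ℕ → Set
Distinct [] = ⊤
Distinct (x ∷ xs) = elemᵇ x xs ≡ false × Distinct xs

elemᵇ-++ : ∀ x xs ys → elemᵇ x (xs ++ ys) ≡ (elemᵇ x xs ∨ elemᵇ x ys)
elemᵇ-++ x [] ys = refl
elemᵇ-++ x (y ∷ xs) ys = trans (cong ((x ≡ᵇ y) ∨_) (elemᵇ-++ x xs ys)) (sym (∨-assoc (x ≡ᵇ y) _ _))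

elemᵇ-[_] : ∀ y x → elemᵇ x (y ∷ []) ≡ (x ≡ᵇ y)
elemᵇ-[ y ] x = ∨-identityʳ (x ≡ᵇ y)

elemᵇ-resp : ∀ {x y} S → (x ≡ᵇ y) ≡ true → elemᵇ x S ≡ elemᵇ y S
elemᵇ-resp {x} {y} S e = cong (λ z → elemᵇ z S) (≡ᵇ⇒≡′ {x} {y} e)

Distinct-++ : ∀ xs ys → Distinct xs → Distinct ys → All (λ x → elemᵇ x ys ≡ false) xs → Distinct (xs ++ ys)
Distinct-++ [] ys _ ys-distinct _ = ys-distinct
Distinct-++ (x ∷ xs) ys (x∉xs , xs-distinct) ys-distinct (x∉ys ∷ disjoint) =
  trans (elemᵇ-++ x xs ys) (cong₂ _∨_ x∉xs x∉ys) , Distinct-++ xs ys xs-distinct ys-distinct disjoint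

Distinct-∷ʳ : ∀ xs y → Distinct xs → All (_< y) xs → Distinct (xs ++ y ∷ [])
Distinct-∷ʳ xs y xs-distinct xs<y =
  Distinct-++ xs (y ∷ []) xs-distinct (refl , tt)
    (All.map (λ {x} x<y → trans (elemᵇ-[ y ] x) (≡ᵇ-false (<⇒≢ x<y))) xs<y)

≡ᵇ-∸-swap : ∀ n x d → x ≤ n → d ≤ n → (n ∸ x ≡ᵇ d) ≡ (x ≡ᵇ n ∸ d)
≡ᵇ-∸-swap n x d x≤n d≤n = ≡ᵇ-cong-iff
  (λ e → trans (sym (m∸[m∸n]≡n x≤n)) (cong (n ∸_) e))
  (λ e → trans (cong (n ∸_) e) (m∸[m∸n]≡n d≤n))

elemᵇ-∸ : ∀ n x D → x ≤ n → All (_≤ n) D → elemᵇ (n ∸ x) D ≡ elemᵇ x (map (n ∸_) D)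
elemᵇ-∸ n x [] x≤n [] = refl
elemᵇ-∸ n x (d ∷ D) x≤n (d≤n ∷ D≤n) = cong₂ _∨_ (≡ᵇ-∸-swap n x d x≤n d≤n) (elemᵇ-∸ n x D x≤n D≤n)

Distinct-map-∸ : ∀ n D → All (_≤ n) D → Distinct D → Distinct (map (n ∸_) D)
Distinct-map-∸ n [] [] _ = tt
Distinct-map-∸ n (d ∷ D) (d≤n ∷ D≤n) (d∉D , D-distinct) =
  trans (sym (elemᵇ-∸ n (n ∸ d) D (m∸n≤m n d) D≤n)) (trans (cong (λ z → elemᵇ z D) (m∸[m∸n]≡n d≤n)) d∉D)
  , Distinct-map-∸ n D D≤n D-distinct

sumBelow-elemᵇ : ∀ n C (h : ℕ → ℕ) → Distinct C → All (_< n) C →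
  sumBelow n (λ x → 𝟙 (elemᵇ x C) * h x) ≡ sumOver C h
sumBelow-elemᵇ n [] h _ _ = sumBelow-zero n _ (λ _ _ → refl)
sumBelow-elemᵇ n (c ∷ C) h (c∉C , C-distinct) (c<n ∷ C<n) = begin
  sumBelow n (λ x → 𝟙 ((x ≡ᵇ c) ∨ elemᵇ x C) * h x)
    ≡⟨ sumBelow-cong n (λ x _ →
         trans (cong (_* h x) (𝟙-∨-disjoint (x ≡ᵇ c) (elemᵇ x C) (λ e → trans (elemᵇ-resp {x} {c} C e) c∉C)))
               (*-distribʳ-+ (h x) (𝟙 (x ≡ᵇ c)) _)) ⟩
  sumBelow n (λ x → 𝟙 (x ≡ᵇ c) * h x + 𝟙 (elemᵇ x C) * h x)
    ≡⟨ sumBelow-+ n _ _ ⟩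
  sumBelow n (λ x → 𝟙 (x ≡ᵇ c) * h x) + sumBelow n (λ x → 𝟙 (elemᵇ x C) * h x)
    ≡⟨ cong₂ _+_ (sumBelow-delta n c h c<n) (sumBelow-elemᵇ n C h C-distinct C<n) ⟩
  h c + sumOver C h ∎

𝟙-elemᵇ : ∀ a D → Distinct D → 𝟙 (elemᵇ a D) ≡ sumOver D (λ z → 𝟙 (z ≡ᵇ a))
𝟙-elemᵇ a [] _ = refl
𝟙-elemᵇ a (d ∷ D) (d∉D , D-distinct) =
  trans (𝟙-∨-disjoint (a ≡ᵇ d) (elemᵇ a D) (λ e → trans (elemᵇ-resp {a} {d} D e) d∉D))
        (cong₂ _+_ (cong 𝟙 (≡ᵇ-sym a d)) (𝟙-elemᵇ a D D-distinct))

schurCount : List ℕ → ℕ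
schurCount D = sumOver D (λ x → sumOver D (λ y → 𝟙 (elemᵇ (x + y) D)))

≡ᵇ-∸-+ : ∀ x y z → 1 ≤ z → (y ∸ x ≡ᵇ z) ≡ (y ≡ᵇ x + z)
≡ᵇ-∸-+ x y z 1≤z = ≡ᵇ-cong-iff
  (λ e → sym (trans (cong (x +_) (sym e)) (m+[n∸m]≡n (x≤y e))))
  (λ e → trans (cong (_∸ x) e) (m+n∸m≡n x z))
  where
  x≤y : y ∸ x ≡ z → x ≤ y
  x≤y e with x ≤? y
  ... | yes x≤y = x≤y
  ... | no x≰y = contradiction (trans (sym (m≤n⇒m∸n≡0 (<⇒≤ (≰⇒> x≰y)))) e) (>⇒≢ 1≤z ∘ sym)

schurCount-differences : ∀ D → Distinct D → All (1 ≤_) D →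
  sumOver D (λ x → sumOver D (λ y → 𝟙 (elemᵇ (y ∸ x) D))) ≡ schurCount D
schurCount-differences D D-distinct D-positive = begin
  sumOver D (λ x → sumOver D (λ y → 𝟙 (elemᵇ (y ∸ x) D)))
    ≡⟨ sumOver-cong′ D (λ x → sumOver-cong′ D (λ y → 𝟙-elemᵇ (y ∸ x) D D-distinct)) ⟩
  sumOver D (λ x → sumOver D (λ y → sumOver D (λ z → 𝟙 (z ≡ᵇ y ∸ x))))
    ≡⟨ sumOver-cong′ D (λ x → sumOver-cong′ D (λ y → sumOver-cong D (All.map (λ {z} 1≤z →
         cong 𝟙 (trans (≡ᵇ-sym z (y ∸ x)) (≡ᵇ-∸-+ x y z 1≤z))) D-positive))) ⟩
  sumOver D (λ x → sumOver D (λ y → sumOver D (λ z → 𝟙 (y ≡ᵇ x + z))))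
    ≡⟨ sumOver-cong′ D (λ x → sumOver-swap D D (λ y z → 𝟙 (y ≡ᵇ x + z))) ⟩
  sumOver D (λ x → sumOver D (λ z → sumOver D (λ y → 𝟙 (y ≡ᵇ x + z))))
    ≡⟨ sumOver-cong′ D (λ x → sumOver-cong′ D (λ z → sym (𝟙-elemᵇ (x + z) D D-distinct))) ⟩
  schurCount D ∎


-- The circulant built from a set D

+-not-multiple : ∀ M i j x → 0 < x → x < M → i * M + x ≢ j * M
+-not-multiple M i j x 0<x x<M e with <-cmp i j
... | tri< i<j _ _ = <⇒≱ (≤-trans (+-monoʳ-< (i * M) x<M) (≤-reflexive (+-comm (i * M) M)))
                         (≤-trans (*-monoˡ-≤ M i<j) (≤-reflexive (sym e)))
... | tri≈ _ refl _ = <-irrefl (sym (+-cancelˡ-≡ (i * M) x 0 (trans e (sym (+-identityʳ _))))) 0<x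
... | tri> _ _ j<i = <⇒≱ (≤-<-trans (*-monoˡ-≤ M (<⇒≤ j<i)) (m<m+n (i * M) 0<x)) (≤-reflexive e)

∸-not-multiple : ∀ M i j x → 0 < x → x < M → 1 ≤ i → i * M ∸ x ≢ j * M
∸-not-multiple M (suc i) j x 0<x x<M _ e =
  +-not-multiple M i j (M ∸ x) (m<n⇒0<n∸m x<M) (∸-monoʳ-< 0<x (<⇒≤ x<M))
    (trans (sym (+-∸-assoc (i * M) (<⇒≤ x<M))) (trans (cong (_∸ x) (+-comm (i * M) M)) e))

-- In ℤ_{6M} the jump 2M has order 3 and 3M has order 2; they are added according to e₃ and e₂.
extraJumps : ℕ → Bool → Bool → List ℕ
extraJumps M e₃ e₂ = (if e₃ then 2 * M ∷ [] else []) ++ (if e₂ then 3 * M ∷ [] else [])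

extraConn : ℕ → Bool → Bool → List ℕ
extraConn M e₃ e₂ = (if e₃ then 2 * M ∷ 4 * M ∷ [] else []) ++ (if e₂ then 3 * M ∷ [] else [])

extraJumps-values : ∀ M e₃ e₂ → All (λ s → s ≡ 2 * M ⊎ s ≡ 3 * M) (extraJumps M e₃ e₂)
extraJumps-values M true true = inj₁ refl ∷ inj₂ refl ∷ []
extraJumps-values M true false = inj₁ refl ∷ []
extraJumps-values M false true = inj₂ refl ∷ []
extraJumps-values M false false = []

elemᵇ-2M-extraJumps : ∀ M e₃ e₂ → 2 * M ≢ 3 * M → elemᵇ (2 * M) (extraJumps M e₃ e₂) ≡ e₃
elemᵇ-2M-extraJumps M true e₂ _ rewrite ≡ᵇ-refl (2 * M) = refl
elemᵇ-2M-extraJumps M false true 2M≢3M rewrite ≡ᵇ-false 2M≢3M = refl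
elemᵇ-2M-extraJumps M false false _ = refl

-- extraConn is extraJumps ∪ −extraJumps in ℤ_{6M}, as seen through y = −x.
extraJumps-∪-neg : ∀ M e₃ e₂ x y → (y ≡ᵇ 2 * M) ≡ (x ≡ᵇ 4 * M) → (y ≡ᵇ 3 * M) ≡ (x ≡ᵇ 3 * M) →
  (elemᵇ x (extraJumps M e₃ e₂) ∨ elemᵇ y (extraJumps M e₃ e₂)) ≡ elemᵇ x (extraConn M e₃ e₂)
extraJumps-∪-neg M true true x y y≡2M y≡3M rewrite y≡2M | y≡3M =
  lemma (x ≡ᵇ 2 * M) (x ≡ᵇ 4 * M) (x ≡ᵇ 3 * M)
  where
  lemma : ∀ a b c → ((a ∨ (c ∨ false)) ∨ (b ∨ (c ∨ false))) ≡ (a ∨ (b ∨ (c ∨ false)))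
  lemma true b c = refl
  lemma false true c = ∨-zeroʳ (c ∨ false)
  lemma false false c = ∨-idem (c ∨ false)
extraJumps-∪-neg M true false x y y≡2M _ rewrite y≡2M = lemma (x ≡ᵇ 2 * M) (x ≡ᵇ 4 * M)
  where
  lemma : ∀ a b → ((a ∨ false) ∨ (b ∨ false)) ≡ (a ∨ (b ∨ false))
  lemma true b = refl
  lemma false b = refl
extraJumps-∪-neg M false true x y _ y≡3M rewrite y≡3M = ∨-idem ((x ≡ᵇ 3 * M) ∨ false)
extraJumps-∪-neg M false false x y _ _ = refl

extraConn-distinct : ∀ M e₃ e₂ → 2 * M ≢ 4 * M → 2 * M ≢ 3 * M → 4 * M ≢ 3 * M →
  Distinct (extraConn M e₃ e₂)
extraConn-distinct M true true a b c = elemᵇ-false (2 * M) _ (a ∷ b ∷ []) , elemᵇ-false (4 * M) _ (c ∷ []) , refl , tt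
extraConn-distinct M true false a b c = elemᵇ-false (2 * M) _ (a ∷ []) , refl , tt
extraConn-distinct M false true a b c = refl , tt
extraConn-distinct M false false a b c = tt

extraConn-multiples : ∀ M e₃ e₂ → All (λ g → Σ ℕ λ j → 2 ≤ j × j ≤ 4 × g ≡ j * M) (extraConn M e₃ e₂)
extraConn-multiples M e₃ e₂ = ++⁺ (pair e₃) (single e₂)
  where
  pair : ∀ b → All (λ g → Σ ℕ λ j → 2 ≤ j × j ≤ 4 × g ≡ j * M) (if b then 2 * M ∷ 4 * M ∷ [] else [])
  pair true = (2 , ≤-refl , s≤s (s≤s z≤n) , refl) ∷ (4 , s≤s (s≤s z≤n) , ≤-refl , refl) ∷ []
  pair false = []
  single : ∀ b → All (λ g → Σ ℕ λ j → 2 ≤ j × j ≤ 4 × g ≡ j * M) (if b then 3 * M ∷ [] else [])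
  single true = (3 , s≤s (s≤s z≤n) , s≤s (s≤s (s≤s z≤n)) , refl) ∷ []
  single false = []

extraConn-bounds : ∀ M e₃ e₂ → All (λ g → 2 * M ≤ g × g ≤ 4 * M) (extraConn M e₃ e₂)
extraConn-bounds M e₃ e₂ =
  All.map (λ { (j , 2≤j , j≤4 , refl) → *-monoˡ-≤ M 2≤j , *-monoˡ-≤ M j≤4 }) (extraConn-multiples M e₃ e₂)

length-extraConn : ∀ M e₃ e₂ → length (extraConn M e₃ e₂) ≡ 2 * 𝟙 e₃ + 𝟙 e₂
length-extraConn M true true = refl
length-extraConn M true false = refl
length-extraConn M false true = refl
length-extraConn M false false = refl

sumOver-extraConn² : ∀ M e₃ e₂ (w : ℕ → ℕ → ℕ) →
  w (2 * M) (2 * M) ≡ 0 → w (2 * M) (4 * M) ≡ 𝟙 e₃ → w (4 * M) (2 * M) ≡ 𝟙 e₃ → w (4 * M) (4 * M) ≡ 0 →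
  w (3 * M) (3 * M) ≡ 0 → w (2 * M) (3 * M) ≡ 0 → w (3 * M) (2 * M) ≡ 0 → w (3 * M) (4 * M) ≡ 0 →
  w (4 * M) (3 * M) ≡ 0 → sumOver (extraConn M e₃ e₂) (λ g → sumOver (extraConn M e₃ e₂) (w g)) ≡ 2 * 𝟙 e₃
sumOver-extraConn² M true true w a b c d e f g h i rewrite a | b | c | d | e | f | g | h | i = refl
sumOver-extraConn² M true false w a b c d _ _ _ _ _ rewrite a | b | c | d = refl
sumOver-extraConn² M false true w _ _ _ _ e _ _ _ _ rewrite e = refl
sumOver-extraConn² M false false w _ _ _ _ _ _ _ _ _ = refl

-- With n = 6M and D far below M, the connection set of S = D ++ extraJumps is
-- C = D ∪ (n − D) ∪ extraConn, and a difference of two elements of C lies in C only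
-- inside the blocks D ∪ (n − D) and extraConn.
module Construction (M′ : ℕ) (D : List ℕ) (D-distinct : Distinct D)
                    (D-small : All (λ d → 1 ≤ d × 3 * d < suc M′) D) (e₃ e₂ : Bool) where

  M n : ℕ
  M = suc M′
  n = 6 * M

  Small : ℕ → Set
  Small d = 1 ≤ d × 3 * d < M

  G G′ D′ S C : List ℕ
  G = extraJumps M e₃ e₂
  G′ = extraConn M e₃ e₂
  D′ = map (n ∸_) D
  S = D ++ G
  C = D ++ (D′ ++ G′)

  A : ℕ → Bool
  A = inConn n S

  small⇒<M : ∀ {d} → Small d → d < M
  small⇒<M {d} (_ , 3d<M) = ≤-<-trans (m≤m+n d (d + (d + 0))) 3d<M

  D<M : All (_< M) D
  D<M = All.map small⇒<M D-small

  D-positive : All (1 ≤_) D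
  D-positive = All.map proj₁ D-small

  M≤n : M ≤ n
  M≤n = m≤m+n M (5 * M)

  small<n : ∀ {d} → Small d → d < n
  small<n sd = <-≤-trans (small⇒<M sd) M≤n

  D≤n : All (_≤ n) D
  D≤n = All.map (λ d<M → ≤-trans (<⇒≤ d<M) M≤n) D<M

  M≤[1+j]M : ∀ j → M ≤ suc j * M
  M≤[1+j]M j = m≤m+n M (j * M)

  kM-mono : ∀ i j → i ≤ j → i * M ≤ j * M
  kM-mono i j = *-monoˡ-≤ M

  kM-injective : ∀ i j → i ≢ j → i * M ≢ j * M
  kM-injective i j i≢j = i≢j ∘ *-cancelʳ-≡ i j M

  kM+z<jM : ∀ k z j → z < M → suc k ≤ j → k * M + z < j * M
  kM+z<jM k z j z<M k<j =
    ≤-trans (+-monoʳ-< (k * M) z<M) (≤-trans (≤-reflexive (+-comm (k * M) M)) (*-monoˡ-≤ M k<j))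

  n∸kM : ∀ i → n ∸ i * M ≡ (6 ∸ i) * M
  n∸kM i = sym (*-distribʳ-∸ M 6 i)

  2M≢3M : 2 * M ≢ 3 * M
  2M≢3M = kM-injective 2 3 (λ ())

  elemᵇ-G : ∀ z → z ≢ 2 * M → z ≢ 3 * M → elemᵇ z G ≡ false
  elemᵇ-G z z≢2M z≢3M = elemᵇ-false z G
    (All.map (λ { (inj₁ refl) → z≢2M ; (inj₂ refl) → z≢3M }) (extraJumps-values M e₃ e₂))

  elemᵇ-D-≥M : ∀ z → M ≤ z → elemᵇ z D ≡ false
  elemᵇ-D-≥M z M≤z = elemᵇ-above z D (All.map (λ d<M → <-≤-trans d<M M≤z) D<M)

  0∉D : elemᵇ 0 D ≡ false
  0∉D = elemᵇ-below 0 D D-positive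

  A-unfold : ∀ z → A z ≡ ((elemᵇ z D ∨ elemᵇ z G) ∨ (elemᵇ (n ∸ z) D ∨ elemᵇ (n ∸ z) G))
  A-unfold z = cong₂ _∨_ (elemᵇ-++ z D G) (elemᵇ-++ (n ∸ z) D G)

  A-small : ∀ z → z < M → A z ≡ elemᵇ z D
  A-small z z<M = trans (A-unfold z)
    (trans (cong₂ (λ a b → (elemᵇ z D ∨ a) ∨ b) z∉G (cong₂ _∨_ −z∉D −z∉G))
           (trans (∨-identityʳ _) (∨-identityʳ _)))
    where
    3M<n-z : 3 * M < n ∸ z
    3M<n-z = m+n≤o⇒m≤o∸n (suc (3 * M)) {z} {n} (kM+z<jM 3 z 6 z<M (s≤s (s≤s (s≤s (s≤s z≤n)))))
    z∉G = elemᵇ-G z (λ e → <⇒≱ z<M (≤-trans (M≤[1+j]M 1) (≤-reflexive (sym e))))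
                    (λ e → <⇒≱ z<M (≤-trans (M≤[1+j]M 2) (≤-reflexive (sym e))))
    −z∉D = elemᵇ-D-≥M (n ∸ z) (≤-trans (M≤[1+j]M 2) (<⇒≤ 3M<n-z))
    −z∉G = elemᵇ-G (n ∸ z) (λ e → <⇒≱ 3M<n-z (≤-trans (≤-reflexive e) (kM-mono 2 3 (s≤s (s≤s z≤n)))))
                           (λ e → <-irrefl (sym e) 3M<n-z)

  A-middle : ∀ z → M ≤ z → z + M ≤ n → z ≢ 2 * M → z ≢ 3 * M → z ≢ 4 * M → A z ≡ false
  A-middle z M≤z z+M≤n z≢2M z≢3M z≢4M = trans (A-unfold z)
    (cong₂ _∨_ (cong₂ _∨_ (elemᵇ-D-≥M z M≤z) (elemᵇ-G z z≢2M z≢3M))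
               (cong₂ _∨_ (elemᵇ-D-≥M (n ∸ z) (m+n≤o⇒m≤o∸n M (subst (_≤ n) (+-comm z M) z+M≤n)))
                          (elemᵇ-G (n ∸ z) (z≢4M ∘ negated 2) (z≢3M ∘ negated 3))))
    where
    negated : ∀ i → n ∸ z ≡ i * M → z ≡ (6 ∸ i) * M
    negated i e = trans (sym (m∸[m∸n]≡n (m+n≤o⇒m≤o z z+M≤n))) (trans (cong (n ∸_) e) (n∸kM i))

  A-0 : A 0 ≡ false
  A-0 = trans (A-unfold 0)
    (cong₂ _∨_ (cong₂ _∨_ 0∉D (elemᵇ-G 0 (λ ()) (λ ())))
               (cong₂ _∨_ (elemᵇ-D-≥M n M≤n) (elemᵇ-G n (kM-injective 6 2 (λ ())) (kM-injective 6 3 (λ ())))))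

  A-M : A (1 * M) ≡ false
  A-M = A-middle (1 * M) (M≤[1+j]M 0) (≤-trans (≤-reflexive (+-comm (1 * M) M)) (kM-mono 2 6 (s≤s (s≤s z≤n))))
          (kM-injective 1 2 (λ ())) (kM-injective 1 3 (λ ())) (kM-injective 1 4 (λ ()))

  A-5M : A (5 * M) ≡ false
  A-5M = A-middle (5 * M) (M≤[1+j]M 4) (≤-reflexive (+-comm (5 * M) M))
           (kM-injective 5 2 (λ ())) (kM-injective 5 3 (λ ())) (kM-injective 5 4 (λ ()))

  A-2M : A (2 * M) ≡ e₃
  A-2M = trans (A-unfold (2 * M))
    (trans (cong₂ _∨_ (cong₂ _∨_ (elemᵇ-D-≥M (2 * M) (M≤[1+j]M 1)) (elemᵇ-2M-extraJumps M e₃ e₂ 2M≢3M))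
                      (trans (cong (λ z → elemᵇ z D ∨ elemᵇ z G) (n∸kM 2))
                             (cong₂ _∨_ (elemᵇ-D-≥M (4 * M) (M≤[1+j]M 3))
                                        (elemᵇ-G (4 * M) (kM-injective 4 2 (λ ())) (kM-injective 4 3 (λ ()))))))
           (∨-identityʳ e₃))

  A-4M : A (4 * M) ≡ e₃
  A-4M = trans (cong A (sym (n∸kM 2))) (trans (inConn-neg n S (2 * M) (kM-mono 2 6 (s≤s (s≤s z≤n)))) A-2M)

  A≡elemᵇ-C : ∀ x → x ≤ n → A x ≡ elemᵇ x C
  A≡elemᵇ-C x x≤n = begin
    A x
      ≡⟨ A-unfold x ⟩
    (elemᵇ x D ∨ elemᵇ x G) ∨ (elemᵇ (n ∸ x) D ∨ elemᵇ (n ∸ x) G)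
      ≡⟨ shuffle (elemᵇ x D) (elemᵇ x G) (elemᵇ (n ∸ x) D) (elemᵇ (n ∸ x) G) ⟩
    elemᵇ x D ∨ (elemᵇ (n ∸ x) D ∨ (elemᵇ x G ∨ elemᵇ (n ∸ x) G))
      ≡⟨ cong₂ (λ a b → elemᵇ x D ∨ (a ∨ b)) (elemᵇ-∸ n x D x≤n D≤n)
               (extraJumps-∪-neg M e₃ e₂ x (n ∸ x) (neg 2 (s≤s (s≤s z≤n))) (neg 3 (s≤s (s≤s (s≤s z≤n))))) ⟩
    elemᵇ x D ∨ (elemᵇ x D′ ∨ elemᵇ x G′)
      ≡⟨ cong (elemᵇ x D ∨_) (sym (elemᵇ-++ x D′ G′)) ⟩
    elemᵇ x D ∨ elemᵇ x (D′ ++ G′)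
      ≡⟨ sym (elemᵇ-++ x D (D′ ++ G′)) ⟩
    elemᵇ x C ∎
    where
    shuffle : ∀ a b c d → ((a ∨ b) ∨ (c ∨ d)) ≡ (a ∨ (c ∨ (b ∨ d)))
    shuffle true b c d = refl
    shuffle false true c d = sym (∨-zeroʳ c)
    shuffle false false c d = refl
    neg : ∀ i → i ≤ 6 → (n ∸ x ≡ᵇ i * M) ≡ (x ≡ᵇ (6 ∸ i) * M)
    neg i i≤6 = trans (≡ᵇ-∸-swap n x (i * M) x≤n (kM-mono i 6 i≤6)) (cong (x ≡ᵇ_) (n∸kM i))

  D′>4M : All (4 * M <_) D′
  D′>4M = map⁺ (All.map (λ {d} d<M → m+n≤o⇒m≤o∸n (suc (4 * M)) {d} {n}
                                        (kM+z<jM 4 d 6 d<M (s≤s (s≤s (s≤s (s≤s (s≤s z≤n))))))) D<M)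

  ∸-small<n : ∀ {x} → Small x → n ∸ x < n
  ∸-small<n {x} sx = ∸-monoʳ-< {n} {x} {0} (proj₁ sx) (≤-trans (<⇒≤ (small⇒<M sx)) M≤n)

  4M<n : 4 * M < n
  4M<n = *-monoˡ-< M {4} {6} (s≤s (s≤s (s≤s (s≤s (s≤s z≤n)))))

  C-distinct : Distinct C
  C-distinct = Distinct-++ D (D′ ++ G′) D-distinct
    (Distinct-++ D′ G′ (Distinct-map-∸ n D D≤n D-distinct)
                 (extraConn-distinct M e₃ e₂ (kM-injective 2 4 (λ ())) 2M≢3M (kM-injective 4 3 (λ ()))) D′∉G′)
    D∉D′++G′
    where
    D′∉G′ : All (λ x → elemᵇ x G′ ≡ false) D′
    D′∉G′ = All.map (λ {x} 4M<x → elemᵇ-above x G′ (All.map (λ b → ≤-<-trans (proj₂ b) 4M<x) (extraConn-bounds M e₃ e₂)))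
                    D′>4M
    D∉D′++G′ : All (λ x → elemᵇ x (D′ ++ G′) ≡ false) D
    D∉D′++G′ = All.map (λ {x} x<M → elemᵇ-below x (D′ ++ G′) (++⁺
                 (All.map (λ 4M<y → <-trans x<M (≤-<-trans (M≤[1+j]M 3) 4M<y)) D′>4M)
                 (All.map (λ b → <-≤-trans x<M (≤-trans (M≤[1+j]M 1) (proj₁ b))) (extraConn-bounds M e₃ e₂)))) D<M

  C<n : All (_< n) C
  C<n = ++⁺ (All.map (λ d<M → <-≤-trans d<M M≤n) D<M)
            (++⁺ (map⁺ (All.map ∸-small<n D-small))
                 (All.map (λ b → ≤-<-trans (proj₂ b) 4M<n) (extraConn-bounds M e₃ e₂)))

  connSize≡ : connSize n S ≡ 2 * length D + (2 * 𝟙 e₃ + 𝟙 e₂)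
  connSize≡ = begin
    sumBelow n (𝟙 ∘ A)
      ≡⟨ sumBelow-cong n (λ x x<n → trans (cong 𝟙 (A≡elemᵇ-C x (<⇒≤ x<n))) (sym (*-identityʳ _))) ⟩
    sumBelow n (λ x → 𝟙 (elemᵇ x C) * 1)
      ≡⟨ sumBelow-elemᵇ n C (λ _ → 1) C-distinct C<n ⟩
    sumOver C (λ _ → 1)
      ≡⟨ sumOver-const1 C ⟩
    length C
      ≡⟨ trans (length-++ D) (cong (length D +_) (trans (length-++ D′)
                 (cong₂ _+_ (length-map (n ∸_) D) (length-extraConn M e₃ e₂)))) ⟩
    length D + (length D + (2 * 𝟙 e₃ + 𝟙 e₂))
      ≡⟨ ring (length D) _ ⟩
    2 * length D + (2 * 𝟙 e₃ + 𝟙 e₂) ∎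
    where
    ring : ∀ a b → a + (a + b) ≡ 2 * a + b
    ring = solve-∀

  edge : ℕ → ℕ → ℕ
  edge x y = 𝟙 (A (δ n x y))

  edge-sym : ∀ x y → x < n → y < n → edge x y ≡ edge y x
  edge-sym x y x<n y<n = cong 𝟙 (inConn-δ-sym n S x y x<n y<n)

  triangleCount≡sumOver-C : triangleCount n S ≡ sumOver C (λ x → sumOver C (edge x))
  triangleCount≡sumOver-C = begin
    sumBelow n (λ x → sumBelow n (λ y → 𝟙 (A x ∧ A y ∧ A (δ n x y))))
      ≡⟨ sumBelow-cong n (λ x _ → sumBelow-cong n (λ y _ →
           trans (𝟙-∧ (A x) (A y ∧ A (δ n x y))) (cong (𝟙 (A x) *_) (𝟙-∧ (A y) (A (δ n x y)))))) ⟩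
    sumBelow n (λ x → sumBelow n (λ y → 𝟙 (A x) * (𝟙 (A y) * edge x y)))
      ≡⟨ sumBelow-cong n (λ x _ → sumBelow-*ˡ n (𝟙 (A x)) (λ y → 𝟙 (A y) * edge x y)) ⟩
    sumBelow n (λ x → 𝟙 (A x) * sumBelow n (λ y → 𝟙 (A y) * edge x y))
      ≡⟨ sumBelow-cong n (λ x x<n → cong₂ _*_ (cong 𝟙 (A≡elemᵇ-C x (<⇒≤ x<n))) (row x)) ⟩
    sumBelow n (λ x → 𝟙 (elemᵇ x C) * sumOver C (edge x))
      ≡⟨ sumBelow-elemᵇ n C _ C-distinct C<n ⟩
    sumOver C (λ x → sumOver C (edge x)) ∎
    where
    row : ∀ x → sumBelow n (λ y → 𝟙 (A y) * edge x y) ≡ sumOver C (edge x)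
    row x = trans (sumBelow-cong n (λ y y<n → cong (λ z → 𝟙 z * edge x y) (A≡elemᵇ-C y (<⇒≤ y<n))))
                  (sumBelow-elemᵇ n C (edge x) C-distinct C<n)

  sum<M : ∀ {x y} → Small x → Small y → x + y < M
  sum<M {x} {y} (_ , 3x<M) (_ , 3y<M) = *-cancelˡ-< 3 (x + y) M (subst (_< 3 * M) (sym (*-distribˡ-+ 3 x y))
    (<-≤-trans (+-mono-< 3x<M 3y<M) (+-monoʳ-≤ M (m≤m+n M (M + 0)))))

  edge-ordered : ∀ x y → x ≤ y → Small y → edge x y ≡ 𝟙 (elemᵇ (y ∸ x) D)
  edge-ordered x y x≤y sy rewrite δ-≤ n x≤y = cong 𝟙 (A-small (y ∸ x) (≤-<-trans (m∸n≤m y x) (small⇒<M sy)))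

  truncated-diff∉D : ∀ {a b} → a ≤ b → 𝟙 (elemᵇ (a ∸ b) D) ≡ 0
  truncated-diff∉D a≤b = cong 𝟙 (trans (cong (λ z → elemᵇ z D) (m≤n⇒m∸n≡0 a≤b)) 0∉D)

  edge-D-D : ∀ x y → Small x → Small y → edge x y ≡ 𝟙 (elemᵇ (y ∸ x) D) + 𝟙 (elemᵇ (x ∸ y) D)
  edge-D-D x y sx sy with x ≤? y
  ... | yes x≤y = trans (edge-ordered x y x≤y sy)
                        (sym (trans (cong (𝟙 (elemᵇ (y ∸ x) D) +_) (truncated-diff∉D x≤y)) (+-identityʳ _)))
  ... | no x≰y = trans (edge-sym x y (small<n sx) (small<n sy))
                       (trans (edge-ordered y x y≤x sx) (sym (cong (_+ 𝟙 (elemᵇ (x ∸ y) D)) (truncated-diff∉D y≤x))))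
    where
    y≤x = <⇒≤ (≰⇒> x≰y)

  edge-D-D′ : ∀ x y → Small x → Small y → edge x (n ∸ y) ≡ 𝟙 (elemᵇ (x + y) D)
  edge-D-D′ x y sx sy = cong 𝟙 (begin
    A (δ n x (n ∸ y))   ≡⟨ cong A (δ-∸ʳ n x y x≤n-y) ⟩
    A (n ∸ (y + x))     ≡⟨ inConn-neg n S (y + x) (<⇒≤ (<-≤-trans y+x<M M≤n)) ⟩
    A (y + x)           ≡⟨ A-small (y + x) y+x<M ⟩
    elemᵇ (y + x) D     ≡⟨ cong (λ z → elemᵇ z D) (+-comm y x) ⟩
    elemᵇ (x + y) D     ∎)
    where
    y+x<M = sum<M sy sx
    x≤n-y : x ≤ n ∸ y
    x≤n-y = m+n≤o⇒m≤o∸n x (<⇒≤ (<-≤-trans (subst (_< M) (+-comm y x) y+x<M) M≤n))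

  edge-D′-D′ : ∀ x y → Small x → Small y → edge (n ∸ x) (n ∸ y) ≡ edge y x
  edge-D′-D′ x y sx sy = cong (𝟙 ∘ A) (δ-∸-∸ n x y (proj₁ sx) (proj₁ sy) (<-≤-trans (sum<M sx sy) M≤n))

  A-jM+x : ∀ j → 2 ≤ j → j ≤ 4 → ∀ x → 0 < x → x < M → A (j * M + x) ≡ false
  A-jM+x j@(suc j′) 2≤j j≤4 x 0<x x<M = A-middle (j * M + x) (≤-trans (M≤[1+j]M j′) (m≤m+n (j * M) x)) jM+x+M≤n
    (+-not-multiple M j 2 x 0<x x<M) (+-not-multiple M j 3 x 0<x x<M) (+-not-multiple M j 4 x 0<x x<M)
    where
    ring : ∀ a b → a * b + b + b ≡ suc (suc a) * b
    ring = solve-∀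
    jM+x+M≤n : j * M + x + M ≤ n
    jM+x+M≤n = <⇒≤ (<-≤-trans (+-monoˡ-< M (+-monoʳ-< (j * M) x<M))
                              (≤-trans (≤-reflexive (ring j M)) (*-monoˡ-≤ M (s≤s (s≤s j≤4)))))

  A-jM∸x : ∀ j → 2 ≤ j → j ≤ 4 → ∀ x → 0 < x → x < M → A (j * M ∸ x) ≡ false
  A-jM∸x j 2≤j j≤4 x 0<x x<M = A-middle (j * M ∸ x) M≤jM-x jM-x+M≤n
    (∸-not-multiple M j 2 x 0<x x<M 1≤j) (∸-not-multiple M j 3 x 0<x x<M 1≤j) (∸-not-multiple M j 4 x 0<x x<M 1≤j)
    where
    1≤j : 1 ≤ j
    1≤j = ≤-trans (s≤s z≤n) 2≤j
    M≤jM-x : M ≤ j * M ∸ x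
    M≤jM-x = m+n≤o⇒m≤o∸n M (<⇒≤ (<-≤-trans (+-monoʳ-< M x<M)
               (≤-trans (≤-reflexive (cong (M +_) (sym (+-identityʳ M)))) (kM-mono 2 j 2≤j))))
    jM-x+M≤n : j * M ∸ x + M ≤ n
    jM-x+M≤n = ≤-trans (+-monoˡ-≤ M (m∸n≤m (j * M) x))
                 (≤-trans (≤-reflexive (+-comm (j * M) M)) (*-monoˡ-≤ M {suc j} {6} (s≤s (≤-trans j≤4 (n≤1+n 4)))))

  edge-D-G′ : ∀ x j → Small x → 2 ≤ j → j ≤ 4 → edge x (j * M) ≡ 0
  edge-D-G′ x j sx 2≤j j≤4 =
    cong 𝟙 (trans (cong A (δ-≤ n x≤jM)) (A-jM∸x j 2≤j j≤4 x (proj₁ sx) (small⇒<M sx)))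
    where
    x≤jM : x ≤ j * M
    x≤jM = ≤-trans (<⇒≤ (small⇒<M sx))
                   (≤-trans (≤-reflexive (sym (*-identityˡ M))) (kM-mono 1 j (≤-trans (s≤s z≤n) 2≤j)))

  edge-D′-G′ : ∀ x j → Small x → 2 ≤ j → j ≤ 4 → edge (n ∸ x) (j * M) ≡ 0
  edge-D′-G′ x j sx 2≤j j≤4 =
    cong 𝟙 (trans (cong A (δ-∸ˡ n x (j * M) (≤-trans (<⇒≤ (small⇒<M sx)) M≤n) jM<n-x))
                  (A-jM+x j 2≤j j≤4 x (proj₁ sx) (small⇒<M sx)))
    where
    jM<n-x : j * M < n ∸ x
    jM<n-x = m+n≤o⇒m≤o∸n (suc (j * M)) (kM+z<jM j x 6 (small⇒<M sx) (s≤s (≤-trans j≤4 (n≤1+n 4))))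

  δ-kM-≤ : ∀ i j → i ≤ j → δ n (i * M) (j * M) ≡ (j ∸ i) * M
  δ-kM-≤ i j i≤j = trans (δ-≤ n (kM-mono i j i≤j)) (sym (*-distribʳ-∸ M j i))

  δ-kM-> : ∀ i j → j < i → δ n (i * M) (j * M) ≡ (6 + j ∸ i) * M
  δ-kM-> i j j<i = trans (δ-> n (*-monoˡ-< M j<i))
    (trans (cong (_∸ i * M) (sym (*-distribʳ-+ M 6 j))) (sym (*-distribʳ-∸ M (6 + j) i)))

  sum-G′² : sumOver G′ (λ g → sumOver G′ (edge g)) ≡ 2 * 𝟙 e₃
  sum-G′² = sumOver-extraConn² M e₃ e₂ edge
    (cong 𝟙 (trans (cong A (δ-self n (2 * M))) A-0))
    (cong 𝟙 (trans (cong A (δ-kM-≤ 2 4 (s≤s (s≤s z≤n)))) A-2M))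
    (cong 𝟙 (trans (cong A (δ-kM-> 4 2 (s≤s (s≤s (s≤s z≤n))))) A-4M))
    (cong 𝟙 (trans (cong A (δ-self n (4 * M))) A-0))
    (cong 𝟙 (trans (cong A (δ-self n (3 * M))) A-0))
    (cong 𝟙 (trans (cong A (δ-kM-≤ 2 3 (s≤s (s≤s z≤n)))) A-M))
    (cong 𝟙 (trans (cong A (δ-kM-> 3 2 (s≤s (s≤s (s≤s z≤n))))) A-5M))
    (cong 𝟙 (trans (cong A (δ-kM-≤ 3 4 (s≤s (s≤s (s≤s z≤n))))) A-M))
    (cong 𝟙 (trans (cong A (δ-kM-> 4 3 (s≤s (s≤s (s≤s (s≤s z≤n)))))) A-5M))

  sumOver-C : ∀ (h : ℕ → ℕ) → sumOver C h ≡ sumOver D h + (sumOver D (h ∘ (n ∸_)) + sumOver G′ h)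
  sumOver-C h = trans (sumOver-++ D (D′ ++ G′) h)
    (cong (sumOver D h +_) (trans (sumOver-++ D′ G′ h) (cong (_+ sumOver G′ h) (sumOver-map (n ∸_) D h))))

  sumOver-G′-zero : ∀ (h : ℕ → ℕ) → (∀ j → 2 ≤ j → j ≤ 4 → h (j * M) ≡ 0) → sumOver G′ h ≡ 0
  sumOver-G′-zero h h-zero = trans (sumOver-cong G′ (All.map (λ { (j , 2≤j , j≤4 , refl) → h-zero j 2≤j j≤4 })
                                                              (extraConn-multiples M e₃ e₂)))
                                   (sumOver-zero G′)

  sumOver-D-zero : ∀ (h : ℕ → ℕ) → (∀ x → Small x → h x ≡ 0) → sumOver D h ≡ 0
  sumOver-D-zero h h-zero = trans (sumOver-cong D (All.map (λ {x} → h-zero x) D-small)) (sumOver-zero D)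

  forward backward plus : ℕ → ℕ
  forward x = sumOver D (λ y → 𝟙 (elemᵇ (y ∸ x) D))
  backward x = sumOver D (λ y → 𝟙 (elemᵇ (x ∸ y) D))
  plus x = sumOver D (λ y → 𝟙 (elemᵇ (x + y) D))

  row-D : ∀ x → Small x → sumOver C (edge x) ≡ forward x + backward x + plus x
  row-D x sx = begin
    sumOver C (edge x)
      ≡⟨ sumOver-C (edge x) ⟩
    sumOver D (edge x) + (sumOver D (λ y → edge x (n ∸ y)) + sumOver G′ (edge x))
      ≡⟨ cong₂ _+_ (trans (sumOver-cong D (All.map (λ {y} sy → edge-D-D x y sx sy) D-small)) (sumOver-+ D _ _))
                   (cong₂ _+_ (sumOver-cong D (All.map (λ {y} sy → edge-D-D′ x y sx sy) D-small))
                              (sumOver-G′-zero (edge x) (λ j → edge-D-G′ x j sx))) ⟩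
    forward x + backward x + (plus x + 0)
      ≡⟨ cong (forward x + backward x +_) (+-identityʳ (plus x)) ⟩
    forward x + backward x + plus x ∎

  edge-D′-D : ∀ x y → Small x → Small y → edge (n ∸ x) y ≡ 𝟙 (elemᵇ (x + y) D)
  edge-D′-D x y sx sy = trans (edge-sym (n ∸ x) y (∸-small<n sx) (small<n sy))
    (trans (edge-D-D′ y x sy sx) (cong (λ z → 𝟙 (elemᵇ z D)) (+-comm y x)))

  row-D′ : ∀ x → Small x → sumOver C (edge (n ∸ x)) ≡ plus x + backward x + forward x
  row-D′ x sx = begin
    sumOver C (edge (n ∸ x))
      ≡⟨ sumOver-C (edge (n ∸ x)) ⟩
    sumOver D (edge (n ∸ x)) + (sumOver D (λ y → edge (n ∸ x) (n ∸ y)) + sumOver G′ (edge (n ∸ x)))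
      ≡⟨ cong₂ _+_ (sumOver-cong D (All.map (λ {y} sy → edge-D′-D x y sx sy) D-small))
                   (cong₂ _+_ (trans (sumOver-cong D (All.map (λ {y} sy → trans (edge-D′-D′ x y sx sy) (edge-D-D y x sy sx))
                                                              D-small))
                                     (sumOver-+ D _ _))
                              (sumOver-G′-zero (edge (n ∸ x)) (λ j → edge-D′-G′ x j sx))) ⟩
    plus x + ((backward x + forward x) + 0)
      ≡⟨ ring (plus x) (backward x) (forward x) ⟩
    plus x + backward x + forward x ∎
    where
    ring : ∀ p q r → p + ((q + r) + 0) ≡ p + q + r
    ring = solve-∀

  row-G′ : ∀ j → 2 ≤ j → j ≤ 4 → sumOver C (edge (j * M)) ≡ sumOver G′ (edge (j * M))
  row-G′ j 2≤j j≤4 = trans (sumOver-C (edge (j * M)))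
    (cong₂ _+_ (sumOver-D-zero (edge (j * M))
                 (λ y sy → trans (edge-sym (j * M) y jM<n (small<n sy)) (edge-D-G′ y j sy 2≤j j≤4)))
               (cong (_+ sumOver G′ (edge (j * M)))
                     (sumOver-D-zero (λ y → edge (j * M) (n ∸ y))
                       (λ y sy → trans (edge-sym (j * M) (n ∸ y) jM<n (∸-small<n sy))
                                       (edge-D′-G′ y j sy 2≤j j≤4)))))
    where
    jM<n : j * M < n
    jM<n = ≤-<-trans (kM-mono j 4 j≤4) 4M<n

  triangleCount≡ : triangleCount n S ≡ 6 * schurCount D + 2 * 𝟙 e₃
  triangleCount≡ = begin
    triangleCount n S
      ≡⟨ triangleCount≡sumOver-C ⟩
    sumOver C (λ x → sumOver C (edge x))
      ≡⟨ sumOver-C (λ x → sumOver C (edge x)) ⟩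
    sumOver D (λ x → sumOver C (edge x))
      + (sumOver D (λ x → sumOver C (edge (n ∸ x))) + sumOver G′ (λ g → sumOver C (edge g)))
      ≡⟨ cong₂ _+_ (trans (sumOver-cong D (All.map (λ {x} → row-D x) D-small)) (sumOver-+₃ forward backward plus))
                   (cong₂ _+_ (trans (sumOver-cong D (All.map (λ {x} → row-D′ x) D-small)) (sumOver-+₃ plus backward forward))
                              (trans (sumOver-cong G′ (All.map (λ { (j , 2≤j , j≤4 , refl) → row-G′ j 2≤j j≤4 })
                                                               (extraConn-multiples M e₃ e₂)))
                                     sum-G′²)) ⟩
    (Σforward + Σbackward + Σplus) + ((Σplus + Σbackward + Σforward) + 2 * 𝟙 e₃)
      ≡⟨ cong₂ (λ u v → u + (v + 2 * 𝟙 e₃)) (cong₂ (λ p q → p + q + Σplus) Σforward≡ Σbackward≡)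
               (cong₂ (λ p q → Σplus + p + q) Σbackward≡ Σforward≡) ⟩
    (schurCount D + schurCount D + schurCount D) + ((schurCount D + schurCount D + schurCount D) + 2 * 𝟙 e₃)
      ≡⟨ ring (schurCount D) (2 * 𝟙 e₃) ⟩
    6 * schurCount D + 2 * 𝟙 e₃ ∎
    where
    Σforward = sumOver D forward
    Σbackward = sumOver D backward
    Σplus = sumOver D plus
    Σforward≡ : Σforward ≡ schurCount D
    Σforward≡ = schurCount-differences D D-distinct D-positive
    Σbackward≡ : Σbackward ≡ schurCount D
    Σbackward≡ = trans (sumOver-swap D D (λ x y → 𝟙 (elemᵇ (x ∸ y) D))) Σforward≡
    sumOver-+₃ : ∀ (f g h : ℕ → ℕ) →
      sumOver D (λ x → f x + g x + h x) ≡ sumOver D f + sumOver D g + sumOver D h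
    sumOver-+₃ f g h = trans (sumOver-+ D (λ x → f x + g x) h) (cong (_+ sumOver D h) (sumOver-+ D f g))
    ring : ∀ s t → (s + s + s) + ((s + s + s) + t) ≡ 6 * s + t
    ring = solve-∀

  valid : ValidJumps n S
  valid = ++⁺ (All.map (λ sd → proj₁ sd , ≤-trans (<⇒≤ (small⇒<M sd)) (≤-trans (M≤[1+j]M 2) (≤-reflexive (sym n/2))))
                       D-small)
              (All.map (λ { (inj₁ refl) → s≤s z≤n , ≤-trans (kM-mono 2 3 (s≤s (s≤s z≤n))) (≤-reflexive (sym n/2))
                          ; (inj₂ refl) → s≤s z≤n , ≤-reflexive (sym n/2) })
                       (extraJumps-values M e₃ e₂))
    where
    ring : ∀ M → 6 * M ≡ 3 * M * 2
    ring = solve-∀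
    n/2 : n / 2 ≡ 3 * M
    n/2 = trans (cong (_/ 2) (ring M)) (m*n/n≡m (3 * M) 2)

  isRC : IsRCCirc n S (2 * length D + (2 * 𝟙 e₃ + 𝟙 e₂)) (3 * schurCount D + 𝟙 e₃)
  isRC v = trans (degree≡connSize n S v) connSize≡ ,
           *-cancelˡ-≡ (eNbhd n S v) (3 * schurCount D + 𝟙 e₃) 2
             (trans (twice-eNbhd≡triangleCount n S v A-0) (trans triangleCount≡ (ring (schurCount D) (𝟙 e₃))))
    where
    ring : ∀ s t → 6 * s + 2 * t ≡ 2 * (3 * s + t)
    ring = solve-∀

circulant-from-set : ∀ D bound → Distinct D → All (λ x → 1 ≤ x × x < bound) D → ∀ e₃ e₂ →
  ExistsRCCirculant (2 * length D + (2 * 𝟙 e₃ + 𝟙 e₂)) (3 * schurCount D + 𝟙 e₃)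
circulant-from-set D bound D-distinct D-bounded e₃ e₂ =
  n , S , ≤-trans (s≤s (s≤s z≤n)) (*-monoʳ-≤ 6 (s≤s z≤n)) , valid , isRC
  where
  D-small : All (λ d → 1 ≤ d × 3 * d < suc (3 * bound)) D
  D-small = All.map (λ (1≤d , d<bound) → 1≤d , s≤s (*-monoʳ-≤ 3 (<⇒≤ d<bound))) D-bounded
  open Construction (3 * bound) D D-distinct D-small e₃ e₂


-- Sets with a prescribed Schur count

pairCount : List ℕ → ℕ → ℕ
pairCount D f = sumOver D (λ x → sumOver D (λ y → 𝟙 (x + y ≡ᵇ f)))

sumOver-∷ʳ : {A : Set} (xs : List A) (y : A) (f : A → ℕ) → sumOver (xs ++ y ∷ []) f ≡ sumOver xs f + f y
sumOver-∷ʳ xs y f = trans (sumOver-++ xs (y ∷ []) f) (cong (sumOver xs f +_) (+-identityʳ (f y)))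

elemᵇ-∷ʳ : ∀ z xs y → elemᵇ z (xs ++ y ∷ []) ≡ (elemᵇ z xs ∨ (z ≡ᵇ y))
elemᵇ-∷ʳ z xs y = trans (elemᵇ-++ z xs (y ∷ [])) (cong (elemᵇ z xs ∨_) (elemᵇ-[ y ] z))

schurCount-∷ʳ : ∀ D f → 1 ≤ f → All (λ x → 1 ≤ x × x < f) D →
  schurCount (D ++ f ∷ []) ≡ schurCount D + pairCount D f
schurCount-∷ʳ D f 1≤f D-bounds = begin
  schurCount (D ++ f ∷ [])
    ≡⟨ sumOver-∷ʳ D f row ⟩
  sumOver D row + row f
    ≡⟨ cong₂ _+_ (sumOver-cong D (All.map (λ {x} (1≤x , _) → row-D x 1≤x) D-bounds)) row-f ⟩
  sumOver D (λ x → sumOver D (λ y → 𝟙 (elemᵇ (x + y) D)) + sumOver D (λ y → 𝟙 (x + y ≡ᵇ f))) + 0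
    ≡⟨ trans (+-identityʳ _) (sumOver-+ D _ _) ⟩
  schurCount D + pairCount D f ∎
  where
  D<f : All (_< f) D
  D<f = All.map proj₂ D-bounds
  E : ℕ → ℕ
  E z = 𝟙 (elemᵇ z (D ++ f ∷ []))
  row : ℕ → ℕ
  row x = sumOver (D ++ f ∷ []) (λ y → E (x + y))
  E-above : ∀ z → f < z → E z ≡ 0
  E-above z f<z = cong 𝟙 (trans (elemᵇ-∷ʳ z D f)
    (cong₂ _∨_ (elemᵇ-above z D (All.map (λ x<f → <-trans x<f f<z) D<f)) (≡ᵇ-false (>⇒≢ f<z))))
  E-split : ∀ z → E z ≡ 𝟙 (elemᵇ z D) + 𝟙 (z ≡ᵇ f)
  E-split z = trans (cong 𝟙 (elemᵇ-∷ʳ z D f)) (𝟙-∨-disjoint (elemᵇ z D) (z ≡ᵇ f)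
    (λ z∈D → ≡ᵇ-false {z} {f} (λ { refl → contradiction (trans (sym z∈D) (elemᵇ-above z D D<f)) (λ ()) })))
  row-D : ∀ x → 1 ≤ x → row x ≡ sumOver D (λ y → 𝟙 (elemᵇ (x + y) D)) + sumOver D (λ y → 𝟙 (x + y ≡ᵇ f))
  row-D x 1≤x = trans (sumOver-∷ʳ D f (λ y → E (x + y)))
    (trans (cong₂ _+_ (trans (sumOver-cong′ D (λ y → E-split (x + y))) (sumOver-+ D _ _))
                      (E-above (x + f) (m<n+m f 1≤x)))
           (+-identityʳ _))
  row-f : row f ≡ 0
  row-f = trans (sumOver-∷ʳ D f (λ y → E (f + y)))
    (cong₂ _+_ (trans (sumOver-cong D (All.map (λ (1≤y , _) → E-above (f + _) (m<m+n f 1≤y)) D-bounds))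
                      (sumOver-zero D))
               (E-above (f + f) (m<m+n f 1≤f)))

pairCount-large : ∀ D f → All (λ x → 2 * x < f) D → pairCount D f ≡ 0
pairCount-large D f D-bounds =
  trans (sumOver-cong D (All.map (λ {x} 2x<f → trans (sumOver-cong D (All.map (λ {y} 2y<f →
          cong 𝟙 (≡ᵇ-false {x + y} {f} (<⇒≢ (sum<f {x} {y} 2x<f 2y<f)))) D-bounds)) (sumOver-zero D)) D-bounds))
        (sumOver-zero D)
  where
  sum<f : ∀ {x y} → 2 * x < f → 2 * y < f → x + y < f
  sum<f {x} {y} 2x<f 2y<f = *-cancelˡ-< 2 (x + y) f
    (subst (_< 2 * f) (sym (*-distribˡ-+ 2 x y)) (subst (2 * x + 2 * y <_) (ring f) (+-mono-< 2x<f 2y<f)))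
    where
    ring : ∀ f → f + f ≡ 2 * f
    ring = solve-∀

oneTo : ℕ → List ℕ
oneTo zero = []
oneTo (suc k) = oneTo k ++ suc k ∷ []

triangular : ℕ → ℕ
triangular zero = 0
triangular (suc k) = triangular k + k

oneTo-bounds : ∀ k → All (λ x → 1 ≤ x × x ≤ k) (oneTo k)
oneTo-bounds zero = []
oneTo-bounds (suc k) =
  ++⁺ (All.map (λ (1≤x , x≤k) → 1≤x , ≤-trans x≤k (n≤1+n k)) (oneTo-bounds k)) ((s≤s z≤n , ≤-refl) ∷ [])

oneTo-distinct : ∀ k → Distinct (oneTo k)
oneTo-distinct zero = tt
oneTo-distinct (suc k) = Distinct-∷ʳ (oneTo k) (suc k) (oneTo-distinct k) (All.map (s≤s ∘ proj₂) (oneTo-bounds k))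

length-oneTo : ∀ k → length (oneTo k) ≡ k
length-oneTo zero = refl
length-oneTo (suc k) = trans (length-++ (oneTo k)) (trans (cong (_+ 1) (length-oneTo k)) (+-comm k 1))

elemᵇ-oneTo : ∀ k z → 1 ≤ z → z ≤ k → elemᵇ z (oneTo k) ≡ true
elemᵇ-oneTo zero z 1≤z z≤0 = contradiction (≤-trans 1≤z z≤0) λ ()
elemᵇ-oneTo (suc k) z 1≤z z≤1+k with z ≟ suc k
... | yes refl = trans (elemᵇ-∷ʳ z (oneTo k) (suc k))
                       (trans (cong (elemᵇ z (oneTo k) ∨_) (≡ᵇ-refl z)) (∨-zeroʳ _))
... | no z≢1+k = trans (elemᵇ-∷ʳ z (oneTo k) (suc k))
                       (cong (_∨ (z ≡ᵇ suc k)) (elemᵇ-oneTo k z 1≤z (≤-pred (≤∧≢⇒< z≤1+k z≢1+k))))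

count-above : ∀ k j → sumOver (oneTo k) (λ x → 𝟙 (j <ᵇ x)) ≡ k ∸ j
count-above zero j = sym (0∸n≡0 j)
count-above (suc k) j with j ≤? k
... | yes j≤k = trans (sumOver-∷ʳ (oneTo k) (suc k) _)
  (trans (cong₂ _+_ (count-above k j) (cong 𝟙 (<ᵇ-true (s≤s j≤k)))) (trans (+-comm (k ∸ j) 1) (sym (+-∸-assoc 1 j≤k))))
... | no j≰k = trans (sumOver-∷ʳ (oneTo k) (suc k) _)
  (trans (cong₂ _+_ (trans (count-above k j) (m≤n⇒m∸n≡0 (<⇒≤ (≰⇒> j≰k)))) (cong 𝟙 (<ᵇ-false (≰⇒> j≰k))))
         (sym (m≤n⇒m∸n≡0 (≰⇒> j≰k))))

-- For x ∈ [1, k] the partner of x in a sum t = k + 1 + j is t − x, which lies in [1, k] iff j < x.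
pairCount-oneTo : ∀ k j → j ≤ k → pairCount (oneTo k) (suc k + j) ≡ k ∸ j
pairCount-oneTo k j j≤k = trans (sumOver-cong (oneTo k) (All.map (λ {x} → partners x) (oneTo-bounds k))) (count-above k j)
  where
  t = suc k + j
  partners : ∀ x → 1 ≤ x × x ≤ k → sumOver (oneTo k) (λ y → 𝟙 (x + y ≡ᵇ t)) ≡ 𝟙 (j <ᵇ x)
  partners x (1≤x , x≤k) = begin
    sumOver (oneTo k) (λ y → 𝟙 (x + y ≡ᵇ t))
      ≡⟨ sumOver-cong′ (oneTo k) (λ y → cong 𝟙 (≡ᵇ-cong-iff {x + y} {t} {y} {t ∸ x}
           (λ e → trans (sym (m+n∸m≡n x y)) (cong (_∸ x) e)) (λ e → trans (cong (x +_) e) (m+[n∸m]≡n x≤t)))) ⟩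
    sumOver (oneTo k) (λ y → 𝟙 (y ≡ᵇ t ∸ x))
      ≡⟨ sym (𝟙-elemᵇ (t ∸ x) (oneTo k) (oneTo-distinct k)) ⟩
    𝟙 (elemᵇ (t ∸ x) (oneTo k))
      ≡⟨ cong 𝟙 partner∈ ⟩
    𝟙 (j <ᵇ x) ∎
    where
    x≤t : x ≤ t
    x≤t = ≤-trans x≤k (≤-trans (n≤1+n k) (m≤m+n (suc k) j))
    partner∈ : elemᵇ (t ∸ x) (oneTo k) ≡ (j <ᵇ x)
    partner∈ with j <? x
    ... | yes j<x = trans (elemᵇ-oneTo k (t ∸ x) 1≤t-x t-x≤k) (sym (<ᵇ-true j<x))
      where
      1≤t-x : 1 ≤ t ∸ x
      1≤t-x = m<n⇒0<n∸m (≤-<-trans x≤k (≤-<-trans (m≤m+n k j) (n<1+n (k + j))))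
      t-x≤k : t ∸ x ≤ k
      t-x≤k = ≤-trans (∸-monoʳ-≤ t j<x) (≤-reflexive (trans (cong (_∸ suc j) (sym (+-suc k j))) (m+n∸n≡m k (suc j))))
    ... | no j≮x = trans (elemᵇ-above (t ∸ x) (oneTo k) (All.map (λ (_ , y≤k) → ≤-<-trans y≤k k<t-x) (oneTo-bounds k)))
                         (sym (<ᵇ-false (≮⇒≥ j≮x)))
      where
      k<t-x : k < t ∸ x
      k<t-x = ≤-trans (≤-reflexive (sym (m+n∸n≡m (suc k) j))) (∸-monoʳ-≤ t (≮⇒≥ j≮x))

oneTo-below : ∀ k → All (λ x → 1 ≤ x × x < suc k) (oneTo k)
oneTo-below k = All.map (λ (1≤x , x≤k) → 1≤x , s≤s x≤k) (oneTo-bounds k)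

schurCount-oneTo : ∀ k → schurCount (oneTo k) ≡ triangular k
schurCount-oneTo zero = refl
schurCount-oneTo (suc k) = trans (schurCount-∷ʳ (oneTo k) (suc k) (s≤s z≤n) (oneTo-below k))
  (cong₂ _+_ (schurCount-oneTo k)
             (trans (cong (pairCount (oneTo k)) (sym (+-identityʳ (suc k)))) (pairCount-oneTo k 0 z≤n)))

schurWitness : ℕ → ℕ → List ℕ
schurWitness k m = oneTo k ++ (suc k + (k ∸ m)) ∷ []

schurCount-schurWitness : ∀ k m → m ≤ k → schurCount (schurWitness k m) ≡ triangular k + m
schurCount-schurWitness k m m≤k =
  trans (schurCount-∷ʳ (oneTo k) (suc k + (k ∸ m)) (s≤s z≤n)
          (All.map (λ (1≤x , x<1+k) → 1≤x , ≤-trans x<1+k (m≤m+n (suc k) _)) (oneTo-below k)))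
        (cong₂ _+_ (schurCount-oneTo k) (trans (pairCount-oneTo k (k ∸ m) (m∸n≤m k m)) (m∸[m∸n]≡n m≤k)))

schurWitness-distinct : ∀ k m → Distinct (schurWitness k m)
schurWitness-distinct k m = Distinct-∷ʳ (oneTo k) _ (oneTo-distinct k)
  (All.map (λ (_ , x≤k) → ≤-trans (s≤s x≤k) (m≤m+n (suc k) (k ∸ m))) (oneTo-bounds k))

schurWitness-bounds : ∀ k m → All (λ x → 1 ≤ x × x ≤ suc k + (k ∸ m)) (schurWitness k m)
schurWitness-bounds k m = ++⁺ (All.map (λ (1≤x , x≤k) → 1≤x , ≤-trans x≤k (≤-trans (n≤1+n k) (m≤m+n (suc k) (k ∸ m))))
                                       (oneTo-bounds k))
                              ((s≤s z≤n , ≤-refl) ∷ [])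

length-schurWitness : ∀ k m → length (schurWitness k m) ≡ suc k
length-schurWitness k m = trans (length-++ (oneTo k)) (trans (cong (_+ 1) (length-oneTo k)) (+-comm k 1))

SumFreeBelow : ℕ → List ℕ → Set
SumFreeBelow a D = All (λ x → 1 ≤ x × 2 * x < a) D

-- Appends a, 2a + 1, 4a + 3, …: each new element exceeds twice all earlier ones, so no new Schur pairs.
pad : List ℕ → ℕ → ℕ → List ℕ
pad D a zero = D
pad D a (suc j) = pad (D ++ a ∷ []) (suc (2 * a)) j

padBound : ℕ → ℕ → ℕ
padBound a zero = a
padBound a (suc j) = padBound (suc (2 * a)) j

SumFreeBelow-∷ʳ : ∀ a D → 1 ≤ a → SumFreeBelow a D → SumFreeBelow (suc (2 * a)) (D ++ a ∷ [])
SumFreeBelow-∷ʳ a D 1≤a below =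
  ++⁺ (All.map (λ (1≤x , 2x<a) → 1≤x , <-trans 2x<a (s≤s (m≤m+n a (a + 0)))) below) ((1≤a , ≤-refl) ∷ [])

SumFreeBelow⇒< : ∀ a D → SumFreeBelow a D → All (λ x → 1 ≤ x × x < a) D
SumFreeBelow⇒< a D = All.map (λ {x} (1≤x , 2x<a) → 1≤x , ≤-<-trans (m≤m+n x (x + 0)) 2x<a)

pad-distinct : ∀ j D a → 1 ≤ a → Distinct D → SumFreeBelow a D → Distinct (pad D a j)
pad-distinct zero D a _ D-distinct _ = D-distinct
pad-distinct (suc j) D a 1≤a D-distinct below = pad-distinct j (D ++ a ∷ []) (suc (2 * a)) (s≤s z≤n)
  (Distinct-∷ʳ D a D-distinct (All.map proj₂ (SumFreeBelow⇒< a D below))) (SumFreeBelow-∷ʳ a D 1≤a below)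

schurCount-pad : ∀ j D a → 1 ≤ a → SumFreeBelow a D → schurCount (pad D a j) ≡ schurCount D
schurCount-pad zero D a _ _ = refl
schurCount-pad (suc j) D a 1≤a below = begin
  schurCount (pad (D ++ a ∷ []) (suc (2 * a)) j)
    ≡⟨ schurCount-pad j (D ++ a ∷ []) (suc (2 * a)) (s≤s z≤n) (SumFreeBelow-∷ʳ a D 1≤a below) ⟩
  schurCount (D ++ a ∷ [])
    ≡⟨ schurCount-∷ʳ D a 1≤a (SumFreeBelow⇒< a D below) ⟩
  schurCount D + pairCount D a
    ≡⟨ cong (schurCount D +_) (pairCount-large D a (All.map proj₂ below)) ⟩
  schurCount D + 0
    ≡⟨ +-identityʳ _ ⟩
  schurCount D ∎

length-pad : ∀ j D a → length (pad D a j) ≡ length D + j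
length-pad zero D a = sym (+-identityʳ _)
length-pad (suc j) D a = trans (length-pad j (D ++ a ∷ []) (suc (2 * a)))
  (trans (cong (_+ j) (length-++ D)) (trans (+-assoc (length D) 1 j) refl))

pad-bounds : ∀ j D a → 1 ≤ a → SumFreeBelow a D → All (λ x → 1 ≤ x × x < padBound a j) (pad D a j)
pad-bounds zero D a _ below = SumFreeBelow⇒< a D below
pad-bounds (suc j) D a 1≤a below =
  pad-bounds j (D ++ a ∷ []) (suc (2 * a)) (s≤s z≤n) (SumFreeBelow-∷ʳ a D 1≤a below)

circulant-from-padded-set : ∀ D a → 1 ≤ a → Distinct D → SumFreeBelow a D → ∀ j e₃ e₂ →
  ExistsRCCirculant (2 * (length D + j) + (2 * 𝟙 e₃ + 𝟙 e₂)) (3 * schurCount D + 𝟙 e₃)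
circulant-from-padded-set D a 1≤a D-distinct below j e₃ e₂ =
  subst₂ ExistsRCCirculant (cong (λ l → 2 * l + (2 * 𝟙 e₃ + 𝟙 e₂)) (length-pad j D a))
                           (cong (λ s → 3 * s + 𝟙 e₃) (schurCount-pad j D a 1≤a below))
    (circulant-from-set (pad D a j) (padBound a j) (pad-distinct j D a 1≤a D-distinct below)
                        (pad-bounds j D a 1≤a below) e₃ e₂)

-- Parts (b) and (c)

halve : ∀ r → Σ ℕ λ h → Σ Bool λ b → r ≡ 2 * h + 𝟙 b
halve zero = 0 , false , refl
halve (suc r) with halve r
... | h , false , r≡ = h , true , trans (cong suc r≡) (ring h)
  where
  ring : ∀ h → suc (2 * h + 0) ≡ 2 * h + 1
  ring = solve-∀
... | h , true , r≡ = suc h , false , trans (cong suc r≡) (ring h)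
  where
  ring : ∀ h → suc (2 * h + 1) ≡ 2 * suc h + 0
  ring = solve-∀

half-≤ : ∀ a h b → 2 * a ≤ 2 * h + 𝟙 b → a ≤ h
half-≤ a h b 2a≤ = ≤-pred (*-cancelˡ-< 2 a (suc h)
  (≤-<-trans 2a≤ (≤-<-trans (+-monoʳ-≤ (2 * h) (𝟙≤1 b)) (≤-reflexive (ring h)))))
  where
  ring : ∀ h → suc (2 * h + 1) ≡ 2 * suc h
  ring = solve-∀

mod3-decomposition : ∀ c → (c % 3 ≡ 0 ⊎ c % 3 ≡ 1) → c ≡ 3 * (c / 3) + 𝟙 (c % 3 ≡ᵇ 1)
mod3-decomposition c c%3 = trans (m≡m%n+[m/n]*n c 3) (trans (+-comm (c % 3) _)
  (cong₂ _+_ (*-comm (c / 3) 3) (residue c%3)))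
  where
  residue : (c % 3 ≡ 0 ⊎ c % 3 ≡ 1) → c % 3 ≡ 𝟙 (c % 3 ≡ᵇ 1)
  residue (inj₁ e) rewrite e = refl
  residue (inj₂ e) rewrite e = refl

triangular-decomposition : ∀ t → Σ ℕ λ k → Σ ℕ λ m → 1 ≤ k × m < k × t ≡ triangular k + m
triangular-decomposition zero = 1 , 0 , s≤s z≤n , s≤s z≤n , refl
triangular-decomposition (suc t) with triangular-decomposition t
... | k , m , 1≤k , m<k , t≡ with suc m <? k
...   | yes 1+m<k = k , suc m , 1≤k , 1+m<k , trans (cong suc t≡) (sym (+-suc (triangular k) m))
...   | no 1+m≮k = suc k , 0 , s≤s z≤n , s≤s z≤n ,
  trans (cong suc t≡) (trans (sym (+-suc (triangular k) m))
        (trans (cong (triangular k +_) (≤-antisym m<k (≮⇒≥ 1+m≮k))) (sym (+-identityʳ _))))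

twice-triangular : ∀ k → 2 * triangular (suc k) ≡ suc k * k
twice-triangular zero = refl
twice-triangular (suc k) =
  trans (*-distribˡ-+ 2 (triangular (suc k)) (suc k)) (trans (cong (_+ 2 * suc k) (twice-triangular k)) (ring k))
  where
  ring : ∀ k → suc k * k + 2 * suc k ≡ suc (suc k) * suc k
  ring = solve-∀

-- If r < 2(k + 1 + ε) and k ≥ 2 then (r − 6)² ≤ (2k − 3)², whereas
-- 24 · triangular k = 3(2k − 3)² + 5 + (24k − 32) exceeds the bound.
witness-fits : ∀ r k m ε → 1 ≤ k → ε ≤ 1 → 6 ≤ r →
  8 * (3 * (triangular k + m) + ε) ≤ 3 * (r ∸ 6) ^ 2 + 5 → 2 * (suc k + ε) ≤ r
witness-fits r k m ε 1≤k ε≤1 6≤r bound with 2 * (suc k + ε) ≤? r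
... | yes fits = fits
... | no ¬fits = ⊥-elim (too-small k 1≤k (≰⇒> ¬fits) bound)
  where
  too-small : ∀ k → 1 ≤ k → r < 2 * (suc k + ε) → 8 * (3 * (triangular k + m) + ε) ≤ 3 * (r ∸ 6) ^ 2 + 5 → ⊥
  too-small 1 _ r<4+2ε _ = <⇒≱ (<-≤-trans r<4+2ε (*-monoʳ-≤ 2 (+-monoʳ-≤ 2 ε≤1))) 6≤r
  too-small (suc (suc k′)) _ r< bound′ = <⇒≱ (m<m+n Q {16 + 24 * k′} z<s) (subst (_≤ Q) 24T≡ 24T≤Q)
    where
    Q = 3 * (2 * k′ + 1) ^ 2 + 5
    Tk = triangular (suc (suc k′))
    ring₁ : ∀ k′ → 2 * (suc (suc (suc k′)) + 1) ≡ suc (2 * k′ + 1 + 6)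
    ring₁ = solve-∀
    r≤ : r ≤ 2 * k′ + 1 + 6
    r≤ = ≤-pred (≤-trans r< (≤-trans (*-monoʳ-≤ 2 (+-monoʳ-≤ (suc (suc (suc k′))) ε≤1))
                                    (≤-reflexive (ring₁ k′))))
    r-6≤ : r ∸ 6 ≤ 2 * k′ + 1
    r-6≤ = ≤-trans (∸-monoˡ-≤ 6 r≤) (≤-reflexive (m+n∸n≡m (2 * k′ + 1) 6))
    24T≤Q : 8 * (3 * Tk) ≤ Q
    24T≤Q = ≤-trans (*-monoʳ-≤ 8 (≤-trans (*-monoʳ-≤ 3 (m≤m+n Tk m)) (m≤m+n _ ε)))
                    (≤-trans bound′ (+-monoˡ-≤ 5 (*-monoʳ-≤ 3 (*-mono-≤ r-6≤ (*-mono-≤ r-6≤ ≤-refl)))))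
    ring₂ : ∀ z → 8 * (3 * z) ≡ 12 * (2 * z)
    ring₂ = solve-∀
    ring₃ : ∀ k′ → 12 * (suc (suc k′) * suc k′)
                   ≡ 3 * ((2 * k′ + 1) * ((2 * k′ + 1) * 1)) + 5 + (16 + 24 * k′)
    ring₃ = solve-∀
    24T≡ : 8 * (3 * Tk) ≡ Q + (16 + 24 * k′)
    24T≡ = trans (ring₂ Tk) (trans (cong (12 *_) (twice-triangular (suc k′))) (ring₃ k′))

circulant-exists : ∀ c r → (c % 3 ≡ 0 ⊎ c % 3 ≡ 1) → 6 ≤ r → 8 * c ≤ 3 * (r ∸ 6) ^ 2 + 5 →
  ExistsRCCirculant r c
circulant-exists c r c%3 6≤r bound with triangular-decomposition (c / 3) | halve r
... | k , m , 1≤k , m<k , c/3≡ | h , b , r≡ =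
  subst₂ ExistsRCCirculant degree≡ triangles≡
    (circulant-from-padded-set W a (s≤s z≤n) (schurWitness-distinct k m) W-below j e₃ b)
  where
  W = schurWitness k m
  e₃ = c % 3 ≡ᵇ 1
  ε = 𝟙 e₃
  c≡ : c ≡ 3 * (triangular k + m) + ε
  c≡ = trans (mod3-decomposition c c%3) (cong (λ z → 3 * z + ε) c/3≡)
  fits : suc k + ε ≤ h
  fits = half-≤ (suc k + ε) h b (subst (2 * (suc k + ε) ≤_) r≡
           (witness-fits r k m ε 1≤k (𝟙≤1 e₃) 6≤r (subst (λ z → 8 * z ≤ 3 * (r ∸ 6) ^ 2 + 5) c≡ bound)))
  j = h ∸ (suc k + ε)
  a = suc (2 * (suc k + (k ∸ m)))
  W-below : SumFreeBelow a W
  W-below = All.map (λ (1≤x , x≤) → 1≤x , s≤s (*-monoʳ-≤ 2 x≤)) (schurWitness-bounds k m)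
  ring : ∀ K E J B → 2 * (K + J) + (2 * E + B) ≡ 2 * (K + E + J) + B
  ring = solve-∀
  degree≡ : 2 * (length W + j) + (2 * ε + 𝟙 b) ≡ r
  degree≡ = begin
    2 * (length W + j) + (2 * ε + 𝟙 b)  ≡⟨ cong (λ l → 2 * (l + j) + (2 * ε + 𝟙 b)) (length-schurWitness k m) ⟩
    2 * (suc k + j) + (2 * ε + 𝟙 b)     ≡⟨ ring (suc k) ε j (𝟙 b) ⟩
    2 * (suc k + ε + j) + 𝟙 b           ≡⟨ cong (λ z → 2 * z + 𝟙 b) (m+[n∸m]≡n fits) ⟩
    2 * h + 𝟙 b                         ≡⟨ sym r≡ ⟩
    r                                   ∎
  triangles≡ : 3 * schurCount W + ε ≡ c
  triangles≡ = trans (cong (λ z → 3 * z + ε) (schurCount-schurWitness k m (<⇒≤ m<k))) (sym c≡)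

triangle-free-circulant-exists : ∀ r → ExistsRCCirculant r 0
triangle-free-circulant-exists r with halve r
... | h , b , r≡ = subst (λ d → ExistsRCCirculant d 0) (sym r≡)
  (circulant-from-padded-set [] 1 (s≤s z≤n) tt [] h false b)

mainTheorem2 : ((n : ℕ) (S : List ℕ) (r c : ℕ) → 2 ≤ n → ValidJumps n S →
    IsRCCirc n S r c → c % 3 ≢ 2)
    × ((c r : ℕ) → 0 < c → (c % 3 ≡ 0 ⊎ c % 3 ≡ 1) →
    6 ≤ r → 8 * c ≤ 3 * (r ∸ 6) ^ 2 + 5 →
    ExistsRCCirculant r c)
    × ((r : ℕ) → 1 ≤ r → ExistsRCCirculant r 0)
mainTheorem2 =
  no-circulant-with-c≡2-mod-3 ,
  (λ c r _ → circulant-exists c r) ,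
  (λ r _ → triangle-free-circulant-exists r)
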